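{- Let $\lambda$ be a nonzero real number and $Y$ a random variable as in the context. For all integers $n\ge k\ge0$, \[ S_{1,\lambda}^{Y}(n,k)=\sum_{j=0}^{n-k}\binom{n+j-1}{n+j-k}\binom{2n-k}{n-k-j}(-1)^{j}E[Y]^{ -n-j}S_{2,\lambda}^{Y}(n-k+j,j). \]
   Context: $(x)_{0,\lambda}=1$, $(x)_{n,\lambda}=x(x-\lambda)\cdots(x-(n-1)\lambda)$ for $n\ge1$. $Y$ is a random variable whose moment-generating function $E[e^{tY}]$ exists for $|t|<r$ for some $r>0$, and $E[Y]\neq0$. $E[e_{\lambda}^{Y}(t)]$ denotes the formal power series $\sum_{n\ge0}E[(Y)_{n,\lambda}]\frac{t^n}{n!}$. The probabilistic degenerate Stirling numbers of the second kind: $\frac1{k!}\big(E[e_{\lambda}^{Y}(t)]-1\big)^k=\sum_{n\ge k}S_{2,\lambda}^{Y}(n,k)\frac{t^n}{n!}$. Let $e_{Y,\lambda}(t)=E[e_{\lambda}^{Y}(t)]-1$ (a delta series, linear coefficient $E[Y]\ne0$) and $\bar e_{Y,\lambda}(t)$ its compositional inverse; the probabilistic degenerate Stirling numbers of the first kind: $\frac1{k!}\big(\bar e_{Y,\lambda}(t)\big)^k=\sum_{n\ge k}S_{1,\lambda}^{Y}(n,k)\frac{t^n}{n!}$ ($k\ge0$). -}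

module Defs where

open import Level using (_⊔_)
open import Algebra.Bundles using (CommutativeRing)
open import Data.Nat using (ℕ; zero; suc; _∸_; _!)
open import Data.Nat.Combinatorics using (_C_)
open import Relation.Nullary using (¬_)
open import Data.Product using (_×_)

-- A field of characteristic zero, given as a commutative ring together with
-- a multiplicative inverse for every nonzero element and the requirement that
-- no positive integer n·1 vanishes.  (The real numbers are such a field.)
module _ {c ℓ} (R : CommutativeRing c ℓ) where
  open CommutativeRing R hiding (zero)

  ℕ→R : ℕ → Carrier
  ℕ→R zero    = 0#
  ℕ→R (suc n) = 1# + ℕ→R n

  record Char0Field : Set (c ⊔ ℓ) where
    field
      inv     : Carrier → Carrier
      inv-ok  : ∀ x → ¬ (x ≈ 0#) → x * inv x ≈ 1#
      char0   : ∀ n → ¬ (ℕ→R (suc n) ≈ 0#)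

-- Exponential formal power series over R: a sequence a : ℕ → Carrier stands
-- for the formal series  Σ_{n ≥ 0} a n · tⁿ / n!.
module Series {c ℓ} (R : CommutativeRing c ℓ) (F : Char0Field R) where
  open CommutativeRing R hiding (zero)
  open Char0Field F

  EGF : Set c
  EGF = ℕ → Carrier

  Σ< : ℕ → (ℕ → Carrier) → Carrier
  Σ< zero    f = 0#
  Σ< (suc n) f = Σ< n f + f n

  pow : Carrier → ℕ → Carrier
  pow x zero    = 1#
  pow x (suc n) = pow x n * x

  sign : ℕ → Carrier
  sign j = pow (- 1#) j

  _⊛_ : EGF → EGF → EGF
  (a ⊛ b) n = Σ< (suc n) (λ i → ℕ→R R (n C i) * (a i * b (n ∸ i)))

  one : EGF
  one zero    = 1#
  one (suc n) = 0#

  idS : EGF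
  idS zero          = 0#
  idS (suc zero)    = 1#
  idS (suc (suc n)) = 0#

  powS : EGF → ℕ → EGF
  powS a zero    = one
  powS a (suc k) = powS a k ⊛ a

  divPow : EGF → ℕ → ℕ → Carrier
  divPow a k n = inv (ℕ→R R (k !)) * powS a k n

  -- composition f(g(t)) for g with zero constant term:
  -- f(g(t)) = Σ_k f_k · g(t)^k / k!, and g(t)^k has order ≥ k, so the
  -- coefficient of tⁿ/n! only receives contributions from k ≤ n.
  _∘S_ : EGF → EGF → EGF
  (f ∘S g) n = Σ< (suc n) (λ k → f k * divPow g k n)

  -- moment sequence  m n = E[(Y)_{n,λ}]  gives  E[e_λ^Y(t)] = Σ m n tⁿ/n!;
  -- e_{Y,λ}(t) = E[e_λ^Y(t)] - 1
  eSeries : EGF → EGF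
  eSeries m zero    = m zero - 1#
  eSeries m (suc n) = m (suc n)

  S₂ : EGF → ℕ → ℕ → Carrier
  S₂ m n k = divPow (eSeries m) k n

  -- S_{1,λ}^Y(n,k): coefficient of tⁿ/n! in (1/k!) ē(t)^k, ē the
  -- compositional inverse of e_{Y,λ}
  S₁ : EGF → ℕ → ℕ → Carrier
  S₁ ebar n k = divPow ebar k n

  IsCompInverse : EGF → EGF → Set ℓ
  IsCompInverse e ebar =
    (ebar 0 ≈ 0#) × ((∀ n → (e ∘S ebar) n ≈ idS n) × (∀ n → (ebar ∘S e) n ≈ idS n))

-- Work with ordinary power series: E has coefficients eₙ/n! for e = e_{Y,λ}, and G those of
-- its compositional inverse ē. Lagrange inversion, proved by the residue argument (the
-- coefficient of t⁻¹ in a derivative vanishes), gives n·[tⁿ] Gᵏ = k·[tⁿ⁻ᵏ] (t/E)ⁿ. Writing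
-- t/E = b/X with b = 1/E′(0), X(0) = 1 and s = 1 - X, we have X⁻ⁿ = Σᵢ (n multichoose i) sⁱ and
-- sⁱ = Σⱼ C(i,j) (-X)ʲ. After exchanging the two sums, the inner sum over i collapses by
-- trinomial revision and the hockey-stick identity, while [t^(n-k)] Xʲ = bʲ j! S₂(n-k+j, j)/(n-k+j)!;
-- collecting the factorials yields the two binomial coefficients of the formula.

module Submission where

open import Defs
open import Algebra.Bundles using (CommutativeRing)
open import Data.Nat as ℕ using (ℕ; _∸_; _≤_)
open import Data.Nat.Combinatorics using (_C_)
open import Relation.Nullary using (¬_)

open import Data.Nat using (zero; suc; _!; s≤s; z≤n)
open import Data.Nat.Properties as ℕₚ using (_!≢0; _!*_!≢0)
open import Data.Nat.Combinatorics using (nCk≡n!/k![n-k]!; nCk+nC[k+1]≡[n+1]C[k+1]; nCn≡1; nCk≡nC[n∸k]; k![n∸k]!∣n!; k>n⇒nCk≡0)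
open import Data.Nat.DivMod using (m/n*n≡m)
open import Data.Nat.Solver using (module +-*-Solver)
open import Relation.Binary.PropositionalEquality as ≡ using (_≡_; cong; cong₂)
open import Function using (_∘_)
open import Data.Product using (_,_)
open import Data.Fin using (Fin; toℕ)
open import Relation.Binary.Bundles using (Setoid)
import Relation.Binary.Reasoning.Setoid as SetoidReasoning
import Algebra.Solver.Ring.NaturalCoefficients.Default as NaturalCoefficients

multichoose : ℕ → ℕ → ℕ
multichoose n       zero    = 1
multichoose zero    (suc i) = 0
multichoose (suc n) (suc i) = multichoose (suc n) i ℕ.+ multichoose n (suc i)

C-factorial : ∀ a b → ((a ℕ.+ b) C a) ℕ.* (a ! ℕ.* b !) ≡ (a ℕ.+ b) !
C-factorial a b = begin
  ((a ℕ.+ b) C a) ℕ.* (a ! ℕ.* b !)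
    ≡⟨ cong (λ d → ((a ℕ.+ b) C a) ℕ.* (a ! ℕ.* d !)) (≡.sym (ℕₚ.m+n∸m≡n a b)) ⟩
  ((a ℕ.+ b) C a) ℕ.* (a ! ℕ.* (a ℕ.+ b ∸ a) !)
    ≡⟨ cong (λ x → x ℕ.* (a ! ℕ.* (a ℕ.+ b ∸ a) !)) (nCk≡n!/k![n-k]! a≤a+b) ⟩
  (a ℕ.+ b) ! ℕ./ (a ! ℕ.* (a ℕ.+ b ∸ a) !) ℕ.* (a ! ℕ.* (a ℕ.+ b ∸ a) !)
    ≡⟨ m/n*n≡m (k![n∸k]!∣n! a≤a+b) ⟩
  (a ℕ.+ b) ! ∎
  where
  open ≡.≡-Reasoning
  a≤a+b = ℕₚ.m≤m+n a b
  instance _ = a !* (a ℕ.+ b ∸ a) !≢0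

nC0≡1 : ∀ n → n C 0 ≡ 1
nC0≡1 n = begin
  n C 0       ≡⟨ cong (n C_) (ℕₚ.n∸n≡0 n) ⟨
  n C (n ∸ n) ≡⟨ nCk≡nC[n∸k] (ℕₚ.≤-refl {n}) ⟨
  n C n       ≡⟨ nCn≡1 n ⟩
  1           ∎
  where open ≡.≡-Reasoning

multichoose-suc : ∀ n i → multichoose (suc n) i ≡ (n ℕ.+ i) C i
multichoose-suc n       zero    = ≡.sym (nC0≡1 (n ℕ.+ 0))
multichoose-suc zero    (suc i) = begin
  multichoose 1 i ℕ.+ 0 ≡⟨ ℕₚ.+-identityʳ _ ⟩
  multichoose 1 i       ≡⟨ multichoose-suc 0 i ⟩
  i C i                 ≡⟨ nCn≡1 i ⟩
  1                     ≡⟨ nCn≡1 (suc i) ⟨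
  suc i C suc i         ∎
  where open ≡.≡-Reasoning
multichoose-suc (suc n) (suc i) = begin
  multichoose (2 ℕ.+ n) i ℕ.+ multichoose (suc n) (suc i)
    ≡⟨ cong₂ ℕ._+_ (multichoose-suc (suc n) i) (multichoose-suc n (suc i)) ⟩
  (suc n ℕ.+ i) C i ℕ.+ (n ℕ.+ suc i) C suc i
    ≡⟨ cong (λ m → m C i ℕ.+ (n ℕ.+ suc i) C suc i) (ℕₚ.+-suc n i) ⟨
  (n ℕ.+ suc i) C i ℕ.+ (n ℕ.+ suc i) C suc i
    ≡⟨ nCk+nC[k+1]≡[n+1]C[k+1] (n ℕ.+ suc i) i ⟩
  suc (n ℕ.+ suc i) C suc i ∎
  where open ≡.≡-Reasoning

multichoose-factorial : ∀ n i → multichoose (suc n) i ℕ.* (n ! ℕ.* i !) ≡ (n ℕ.+ i) !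
multichoose-factorial n i = begin
  multichoose (suc n) i ℕ.* (n ! ℕ.* i !) ≡⟨ cong₂ ℕ._*_ (multichoose-suc n i) (ℕₚ.*-comm (n !) (i !)) ⟩
  ((n ℕ.+ i) C i) ℕ.* (i ! ℕ.* n !)      ≡⟨ cong (λ m → (m C i) ℕ.* (i ! ℕ.* n !)) (ℕₚ.+-comm n i) ⟩
  ((i ℕ.+ n) C i) ℕ.* (i ! ℕ.* n !)      ≡⟨ C-factorial i n ⟩
  (i ℕ.+ n) !                            ≡⟨ cong _! (ℕₚ.+-comm i n) ⟩
  (n ℕ.+ i) !                            ∎
  where open ≡.≡-Reasoning

multichoose-*-C : ∀ n j r →
  multichoose (suc n) (j ℕ.+ r) ℕ.* ((j ℕ.+ r) C j) ≡ multichoose (suc n) j ℕ.* multichoose (suc n ℕ.+ j) r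
multichoose-*-C n j r = ℕₚ.*-cancelʳ-≡ _ _ (n ! ℕ.* (j ! ℕ.* r !)) {{ℕₚ.m*n≢0 (n !) _ {{n !≢0}} {{j !* r !≢0}}}} (begin
  multichoose (suc n) (j ℕ.+ r) ℕ.* ((j ℕ.+ r) C j) ℕ.* (n ! ℕ.* (j ! ℕ.* r !))
    ≡⟨ solve 5 (λ A B C D E → A :* B :* (C :* (D :* E)) := A :* (C :* (B :* (D :* E)))) ≡.refl
         (multichoose (suc n) (j ℕ.+ r)) ((j ℕ.+ r) C j) (n !) (j !) (r !) ⟩
  multichoose (suc n) (j ℕ.+ r) ℕ.* (n ! ℕ.* (((j ℕ.+ r) C j) ℕ.* (j ! ℕ.* r !)))
    ≡⟨ cong (λ x → multichoose (suc n) (j ℕ.+ r) ℕ.* (n ! ℕ.* x)) (C-factorial j r) ⟩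
  multichoose (suc n) (j ℕ.+ r) ℕ.* (n ! ℕ.* (j ℕ.+ r) !)
    ≡⟨ multichoose-factorial n (j ℕ.+ r) ⟩
  (n ℕ.+ (j ℕ.+ r)) !
    ≡⟨ cong _! (ℕₚ.+-assoc n j r) ⟨
  (n ℕ.+ j ℕ.+ r) !
    ≡⟨ multichoose-factorial (n ℕ.+ j) r ⟨
  multichoose (suc n ℕ.+ j) r ℕ.* ((n ℕ.+ j) ! ℕ.* r !)
    ≡⟨ cong (λ x → multichoose (suc n ℕ.+ j) r ℕ.* (x ℕ.* r !)) (multichoose-factorial n j) ⟨
  multichoose (suc n ℕ.+ j) r ℕ.* (multichoose (suc n) j ℕ.* (n ! ℕ.* j !) ℕ.* r !)
    ≡⟨ solve 5 (λ A B C D E → A :* (B :* (C :* D) :* E) := B :* A :* (C :* (D :* E))) ≡.refl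
         (multichoose (suc n ℕ.+ j) r) (multichoose (suc n) j) (n !) (j !) (r !) ⟩
  multichoose (suc n) j ℕ.* multichoose (suc n ℕ.+ j) r ℕ.* (n ! ℕ.* (j ! ℕ.* r !)) ∎)
  where
  open ≡.≡-Reasoning
  open +-*-Solver

C-multichoose-factorials : ∀ k L j →
  ((k ℕ.+ L ℕ.+ j) C (L ℕ.+ j)) ℕ.* ((L ℕ.+ j) ! ℕ.* k !) ≡ multichoose (suc (k ℕ.+ L)) j ℕ.* ((k ℕ.+ L) ! ℕ.* j !)
C-multichoose-factorials k L j = begin
  ((k ℕ.+ L ℕ.+ j) C (L ℕ.+ j)) ℕ.* ((L ℕ.+ j) ! ℕ.* k !)   ≡⟨ cong (λ a → (a C (L ℕ.+ j)) ℕ.* ((L ℕ.+ j) ! ℕ.* k !)) k+L+j≡L+j+k ⟩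
  ((L ℕ.+ j ℕ.+ k) C (L ℕ.+ j)) ℕ.* ((L ℕ.+ j) ! ℕ.* k !)   ≡⟨ C-factorial (L ℕ.+ j) k ⟩
  (L ℕ.+ j ℕ.+ k) !                                         ≡⟨ cong _! k+L+j≡L+j+k ⟨
  (k ℕ.+ L ℕ.+ j) !                                         ≡⟨ multichoose-factorial (k ℕ.+ L) j ⟨
  multichoose (suc (k ℕ.+ L)) j ℕ.* ((k ℕ.+ L) ! ℕ.* j !)   ∎
  where
  open ≡.≡-Reasoning
  k+L+j≡L+j+k : k ℕ.+ L ℕ.+ j ≡ L ℕ.+ j ℕ.+ k
  k+L+j≡L+j+k = ≡.trans (ℕₚ.+-assoc k L j) (ℕₚ.+-comm k (L ℕ.+ j))

multichoose≡[2n∸k]C[L∸j] : ∀ k L j → j ≤ L →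
  multichoose (2 ℕ.+ (k ℕ.+ L) ℕ.+ j) (L ∸ j) ≡ (2 ℕ.* suc (k ℕ.+ L) ∸ suc k) C (L ∸ j)
multichoose≡[2n∸k]C[L∸j] k L j j≤L = ≡.trans (multichoose-suc (suc (k ℕ.+ L ℕ.+ j)) (L ∸ j)) (cong (_C (L ∸ j)) top)
  where
  open +-*-Solver
  2n≡k+[2L+1] : 2 ℕ.* suc (k ℕ.+ L) ≡ suc k ℕ.+ suc (k ℕ.+ L ℕ.+ L)
  2n≡k+[2L+1] = solve 2 (λ k L → con 2 :* (con 1 :+ (k :+ L)) := (con 1 :+ k) :+ (con 1 :+ (k :+ L :+ L))) ≡.refl k L
  top : suc (k ℕ.+ L ℕ.+ j) ℕ.+ (L ∸ j) ≡ 2 ℕ.* suc (k ℕ.+ L) ∸ suc k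
  top = begin
    suc (k ℕ.+ L ℕ.+ j ℕ.+ (L ∸ j))         ≡⟨ cong suc (ℕₚ.+-assoc (k ℕ.+ L) j (L ∸ j)) ⟩
    suc (k ℕ.+ L ℕ.+ (j ℕ.+ (L ∸ j)))       ≡⟨ cong (λ a → suc (k ℕ.+ L ℕ.+ a)) (ℕₚ.m+[n∸m]≡n j≤L) ⟩
    suc (k ℕ.+ L ℕ.+ L)                     ≡⟨ ℕₚ.m+n∸m≡n (suc k) _ ⟨
    suc k ℕ.+ suc (k ℕ.+ L ℕ.+ L) ∸ suc k   ≡⟨ cong (_∸ suc k) 2n≡k+[2L+1] ⟨
    2 ℕ.* suc (k ℕ.+ L) ∸ suc k             ∎
    where open ≡.≡-Reasoning

module Summation {c ℓ} (R : CommutativeRing c ℓ) where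
  open CommutativeRing R hiding (zero)
  open import Algebra.Properties.CommutativeSemigroup +-commutativeSemigroup using () renaming (interchange to +-interchange)
  open import Algebra.Properties.Monoid.Sum +-monoid using (sum)
  open SetoidReasoning setoid

  Σ : ℕ → (ℕ → Carrier) → Carrier
  Σ zero    f = 0#
  Σ (suc n) f = Σ n f + f n

  Σ-cong< : ∀ n {f g : ℕ → Carrier} → (∀ i → i ℕ.< n → f i ≈ g i) → Σ n f ≈ Σ n g
  Σ-cong< zero    f≈g = refl
  Σ-cong< (suc n) f≈g = +-cong (Σ-cong< n (λ i i<n → f≈g i (ℕₚ.m<n⇒m<1+n i<n))) (f≈g n ℕₚ.≤-refl)

  Σ-cong : ∀ n {f g : ℕ → Carrier} → (∀ i → f i ≈ g i) → Σ n f ≈ Σ n g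
  Σ-cong n f≈g = Σ-cong< n (λ i _ → f≈g i)

  Σ-congⁿ : ∀ {m n} (f : ℕ → Carrier) → m ≡ n → Σ m f ≈ Σ n f
  Σ-congⁿ f ≡.refl = refl

  Σ-vanish : ∀ n (f : ℕ → Carrier) → (∀ i → i ℕ.< n → f i ≈ 0#) → Σ n f ≈ 0#
  Σ-vanish zero    f f≈0 = refl
  Σ-vanish (suc n) f f≈0 = begin
    Σ n f + f n ≈⟨ +-cong (Σ-vanish n f (λ i i<n → f≈0 i (ℕₚ.m<n⇒m<1+n i<n))) (f≈0 n ℕₚ.≤-refl) ⟩
    0# + 0#     ≈⟨ +-identityˡ 0# ⟩
    0#          ∎

  Σ-head : ∀ n (f : ℕ → Carrier) → Σ (suc n) f ≈ f 0 + Σ n (λ i → f (suc i))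
  Σ-head zero    f = trans (+-identityˡ _) (sym (+-identityʳ _))
  Σ-head (suc n) f = trans (+-congʳ (Σ-head n f)) (+-assoc _ _ _)

  Σ-+-range : ∀ m n (f : ℕ → Carrier) → Σ (m ℕ.+ n) f ≈ Σ m f + Σ n (λ i → f (m ℕ.+ i))
  Σ-+-range m zero    f = trans (Σ-congⁿ f (ℕₚ.+-identityʳ m)) (sym (+-identityʳ _))
  Σ-+-range m (suc n) f = begin
    Σ (m ℕ.+ suc n) f                              ≈⟨ Σ-congⁿ f (ℕₚ.+-suc m n) ⟩
    Σ (m ℕ.+ n) f + f (m ℕ.+ n)                    ≈⟨ +-congʳ (Σ-+-range m n f) ⟩
    (Σ m f + Σ n (λ i → f (m ℕ.+ i))) + f (m ℕ.+ n) ≈⟨ +-assoc _ _ _ ⟩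
    Σ m f + (Σ n (λ i → f (m ℕ.+ i)) + f (m ℕ.+ n)) ∎

  Σ-extend : ∀ m o (f : ℕ → Carrier) → (∀ i → f (m ℕ.+ i) ≈ 0#) → Σ (m ℕ.+ o) f ≈ Σ m f
  Σ-extend m o f f≈0 = begin
    Σ (m ℕ.+ o) f                   ≈⟨ Σ-+-range m o f ⟩
    Σ m f + Σ o (λ i → f (m ℕ.+ i)) ≈⟨ +-congˡ (Σ-vanish o _ (λ i _ → f≈0 i)) ⟩
    Σ m f + 0#                      ≈⟨ +-identityʳ _ ⟩
    Σ m f                           ∎

  Σ-reverse : ∀ n (f : ℕ → Carrier) → Σ (suc n) f ≈ Σ (suc n) (λ i → f (n ∸ i))
  Σ-reverse zero    f = refl
  Σ-reverse (suc n) f = trans (+-congʳ (Σ-reverse n f)) (trans (+-comm _ _) (sym (Σ-head (suc n) (λ i → f (suc n ∸ i)))))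

  sum≈Σ : ∀ n (f : ℕ → Carrier) → sum (λ (i : Fin n) → f (toℕ i)) ≈ Σ n f
  sum≈Σ zero    f = refl
  sum≈Σ (suc n) f = trans (+-congˡ (sum≈Σ n (f ∘ suc))) (sym (Σ-head n f))

  Σ-distrib-+ : ∀ n (f g : ℕ → Carrier) → Σ n (λ i → f i + g i) ≈ Σ n f + Σ n g
  Σ-distrib-+ zero    f g = sym (+-identityˡ 0#)
  Σ-distrib-+ (suc n) f g = trans (+-congʳ (Σ-distrib-+ n f g)) (+-interchange _ _ _ _)

  *-distribˡ-Σ : ∀ n x (f : ℕ → Carrier) → x * Σ n f ≈ Σ n (λ i → x * f i)
  *-distribˡ-Σ zero    x f = zeroʳ x
  *-distribˡ-Σ (suc n) x f = trans (distribˡ x (Σ n f) (f n)) (+-congʳ (*-distribˡ-Σ n x f))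

  *-distribʳ-Σ : ∀ n x (f : ℕ → Carrier) → Σ n f * x ≈ Σ n (λ i → f i * x)
  *-distribʳ-Σ n x f = trans (*-comm _ x) (trans (*-distribˡ-Σ n x f) (Σ-cong n (λ i → *-comm x (f i))))

  Σ-comm : ∀ m n (f : ℕ → ℕ → Carrier) → Σ m (λ i → Σ n (f i)) ≈ Σ n (λ j → Σ m (λ i → f i j))
  Σ-comm zero    n f = sym (Σ-vanish n _ (λ _ _ → refl))
  Σ-comm (suc m) n f = trans (+-congʳ (Σ-comm m n f)) (sym (Σ-distrib-+ n _ _))

module NaturalEmbedding {c ℓ} (R : CommutativeRing c ℓ) where
  open CommutativeRing R hiding (zero)
  open import Algebra.Properties.Semiring.Mult semiring using (_×_; ×-homo-+; ×1-homo-*)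

  ℕ→R≡×1# : ∀ n → ℕ→R R n ≡ n × 1#
  ℕ→R≡×1# zero    = ≡.refl
  ℕ→R≡×1# (suc n) = cong (1# +_) (ℕ→R≡×1# n)

  ℕ→R-+ : ∀ m n → ℕ→R R (m ℕ.+ n) ≈ ℕ→R R m + ℕ→R R n
  ℕ→R-+ m n rewrite ℕ→R≡×1# m | ℕ→R≡×1# n | ℕ→R≡×1# (m ℕ.+ n) = ×-homo-+ 1# m n

  ℕ→R-* : ∀ m n → ℕ→R R (m ℕ.* n) ≈ ℕ→R R m * ℕ→R R n
  ℕ→R-* m n rewrite ℕ→R≡×1# m | ℕ→R≡×1# n | ℕ→R≡×1# (m ℕ.* n) = ×1-homo-* m n

  ℕ→R-1 : ℕ→R R 1 ≈ 1#
  ℕ→R-1 = +-identityʳ 1#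

module MultichooseSums {c ℓ} (R : CommutativeRing c ℓ) where
  open CommutativeRing R hiding (zero)
  open Summation R
  open NaturalEmbedding R using (ℕ→R-+; ℕ→R-*)

  Σ-multichoose : ∀ m L → Σ (suc L) (λ r → ℕ→R R (multichoose m r)) ≈ ℕ→R R (multichoose (suc m) L)
  Σ-multichoose m zero    = +-identityˡ _
  Σ-multichoose m (suc L) = trans (+-congʳ (Σ-multichoose m L)) (sym (ℕ→R-+ (multichoose (suc m) L) (multichoose m (suc L))))

  Σ-multichoose-C : ∀ n j L → j ≤ L →
    Σ (suc L) (λ i → ℕ→R R (multichoose (suc n) i) * ℕ→R R (i C j))
      ≈ ℕ→R R (multichoose (suc n) j) * ℕ→R R (multichoose (2 ℕ.+ n ℕ.+ j) (L ∸ j))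
  Σ-multichoose-C n j L j≤L = begin
    Σ (suc L) f
      ≈⟨ Σ-congⁿ f (≡.trans (ℕₚ.+-suc j (L ∸ j)) (cong suc (ℕₚ.m+[n∸m]≡n j≤L))) ⟨
    Σ (j ℕ.+ suc (L ∸ j)) f
      ≈⟨ Σ-+-range j (suc (L ∸ j)) f ⟩
    Σ j f + Σ (suc (L ∸ j)) (λ r → f (j ℕ.+ r))
      ≈⟨ +-congʳ (Σ-vanish j f below) ⟩
    0# + Σ (suc (L ∸ j)) (λ r → f (j ℕ.+ r))
      ≈⟨ +-identityˡ _ ⟩
    Σ (suc (L ∸ j)) (λ r → f (j ℕ.+ r))
      ≈⟨ Σ-cong (suc (L ∸ j)) revise ⟩
    Σ (suc (L ∸ j)) (λ r → ℕ→R R (multichoose (suc n) j) * ℕ→R R (multichoose (suc n ℕ.+ j) r))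
      ≈⟨ *-distribˡ-Σ (suc (L ∸ j)) _ _ ⟨
    ℕ→R R (multichoose (suc n) j) * Σ (suc (L ∸ j)) (λ r → ℕ→R R (multichoose (suc n ℕ.+ j) r))
      ≈⟨ *-congˡ (Σ-multichoose (suc n ℕ.+ j) (L ∸ j)) ⟩
    ℕ→R R (multichoose (suc n) j) * ℕ→R R (multichoose (2 ℕ.+ n ℕ.+ j) (L ∸ j)) ∎
    where
    open SetoidReasoning setoid
    f : ℕ → Carrier
    f i = ℕ→R R (multichoose (suc n) i) * ℕ→R R (i C j)
    below : ∀ i → i ℕ.< j → f i ≈ 0#
    below i i<j = trans (*-congˡ (reflexive (cong (ℕ→R R) (k>n⇒nCk≡0 i<j)))) (zeroʳ _)
    revise : ∀ r → f (j ℕ.+ r) ≈ ℕ→R R (multichoose (suc n) j) * ℕ→R R (multichoose (suc n ℕ.+ j) r)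
    revise r = begin
      f (j ℕ.+ r)                                                        ≈⟨ ℕ→R-* (multichoose (suc n) (j ℕ.+ r)) ((j ℕ.+ r) C j) ⟨
      ℕ→R R (multichoose (suc n) (j ℕ.+ r) ℕ.* ((j ℕ.+ r) C j))          ≡⟨ cong (ℕ→R R) (multichoose-*-C n j r) ⟩
      ℕ→R R (multichoose (suc n) j ℕ.* multichoose (suc n ℕ.+ j) r)      ≈⟨ ℕ→R-* (multichoose (suc n) j) _ ⟩
      ℕ→R R (multichoose (suc n) j) * ℕ→R R (multichoose (suc n ℕ.+ j) r) ∎

module PowerSeries {c ℓ} (R : CommutativeRing c ℓ) where
  open CommutativeRing R hiding (zero)
  open Summation R
  open NaturalEmbedding R using (ℕ→R-+; ℕ→R-1)
  open MultichooseSums R using (Σ-multichoose-C)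
  open import Algebra.Properties.CommutativeSemiring.Exp commutativeSemiring using (_^_)
  module ≈-Reasoning = SetoidReasoning setoid
  open import Algebra.Properties.CommutativeSemigroup *-commutativeSemigroup using (x∙yz≈y∙xz)
  open import Algebra.Properties.CommutativeSemigroup +-commutativeSemigroup using () renaming (interchange to +-interchange)

  Series : Set c
  Series = ℕ → Carrier

  infix  4 _≋_
  infixl 6 _⊕_
  infixl 7 _⊙_
  infix  8 ⊝_

  _≋_ : Series → Series → Set ℓ
  p ≋ q = ∀ n → p n ≈ q n

  _⊕_ : Series → Series → Series
  (p ⊕ q) n = p n + q n

  ⊝_ : Series → Series
  (⊝ p) n = - p n

  const : Carrier → Series
  const x zero    = x
  const x (suc n) = 0#

  𝟘 𝟙 : Series
  𝟘 n = 0#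
  𝟙 = const 1#

  shift : Series → Series
  shift p n = p (suc n)

  -- Recursion on the first factor makes associativity a plain induction.
  cauchy : ℕ → Series → Series → Carrier
  cauchy zero    p q = p 0 * q 0
  cauchy (suc n) p q = p 0 * q (suc n) + cauchy n (shift p) q

  _⊙_ : Series → Series → Series
  (p ⊙ q) n = cauchy n p q

  cauchy-Σ : ∀ n p q → (p ⊙ q) n ≈ Σ (suc n) (λ i → p i * q (n ∸ i))
  cauchy-Σ zero    p q = sym (+-identityˡ _)
  cauchy-Σ (suc n) p q = trans (+-congˡ (cauchy-Σ n (shift p) q)) (sym (Σ-head (suc n) (λ i → p i * q (suc n ∸ i))))

  ⊙-comm : ∀ p q → p ⊙ q ≋ q ⊙ p
  ⊙-comm p q n = begin
    (p ⊙ q) n                                      ≈⟨ cauchy-Σ n p q ⟩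
    Σ (suc n) (λ i → p i * q (n ∸ i))              ≈⟨ Σ-reverse n _ ⟩
    Σ (suc n) (λ i → p (n ∸ i) * q (n ∸ (n ∸ i)))  ≈⟨ Σ-cong< (suc n) swap ⟩
    Σ (suc n) (λ i → q i * p (n ∸ i))              ≈⟨ cauchy-Σ n q p ⟨
    (q ⊙ p) n                                      ∎
    where
    open ≈-Reasoning
    swap : ∀ i → i ℕ.< suc n → p (n ∸ i) * q (n ∸ (n ∸ i)) ≈ q i * p (n ∸ i)
    swap i i≤n rewrite ℕₚ.m∸[m∸n]≡n (ℕₚ.≤-pred i≤n) = *-comm _ _

  𝟘-⊙ : ∀ q n → (𝟘 ⊙ q) n ≈ 0#
  𝟘-⊙ q zero    = zeroˡ _
  𝟘-⊙ q (suc n) = trans (+-cong (zeroˡ _) (𝟘-⊙ q n)) (+-identityˡ 0#)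

  const-⊙ : ∀ x q n → (const x ⊙ q) n ≈ x * q n
  const-⊙ x q zero    = refl
  const-⊙ x q (suc n) = trans (+-congˡ (𝟘-⊙ q n)) (+-identityʳ _)

  ⊙-distribʳ : ∀ r p q → (p ⊕ q) ⊙ r ≋ p ⊙ r ⊕ q ⊙ r
  ⊙-distribʳ r p q zero    = distribʳ _ _ _
  ⊙-distribʳ r p q (suc n) = trans (+-cong (distribʳ _ _ _) (⊙-distribʳ r (shift p) (shift q) n)) (+-interchange _ _ _ _)

  ⊙-distribˡ : ∀ r p q → r ⊙ (p ⊕ q) ≋ r ⊙ p ⊕ r ⊙ q
  ⊙-distribˡ r p q n = begin
    (r ⊙ (p ⊕ q)) n       ≈⟨ ⊙-comm r (p ⊕ q) n ⟩
    ((p ⊕ q) ⊙ r) n       ≈⟨ ⊙-distribʳ r p q n ⟩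
    (p ⊙ r) n + (q ⊙ r) n ≈⟨ +-cong (⊙-comm p r n) (⊙-comm q r n) ⟩
    (r ⊙ p ⊕ r ⊙ q) n     ∎
    where open ≈-Reasoning

  *-cauchyˡ : ∀ n x p q → cauchy n (λ i → x * p i) q ≈ x * cauchy n p q
  *-cauchyˡ zero    x p q = *-assoc _ _ _
  *-cauchyˡ (suc n) x p q = trans (+-cong (*-assoc _ _ _) (*-cauchyˡ n x (shift p) q)) (sym (distribˡ _ _ _))

  ⊙-assoc : ∀ p q r → (p ⊙ q) ⊙ r ≋ p ⊙ (q ⊙ r)
  ⊙-assoc p q r zero    = *-assoc _ _ _
  ⊙-assoc p q r (suc n) = begin
    (p 0 * q 0) * r (suc n) + cauchy n ((λ i → p 0 * q (suc i)) ⊕ (shift p ⊙ q)) r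
      ≈⟨ +-cong (*-assoc _ _ _) (⊙-distribʳ r _ _ n) ⟩
    p 0 * (q 0 * r (suc n)) + (cauchy n (λ i → p 0 * q (suc i)) r + cauchy n (shift p ⊙ q) r)
      ≈⟨ +-congˡ (+-cong (*-cauchyˡ n (p 0) (shift q) r) (⊙-assoc (shift p) q r n)) ⟩
    p 0 * (q 0 * r (suc n)) + (p 0 * cauchy n (shift q) r + cauchy n (shift p) (q ⊙ r))
      ≈⟨ +-assoc _ _ _ ⟨
    (p 0 * (q 0 * r (suc n)) + p 0 * cauchy n (shift q) r) + cauchy n (shift p) (q ⊙ r)
      ≈⟨ +-congʳ (distribˡ _ _ _) ⟨
    (p ⊙ (q ⊙ r)) (suc n) ∎
    where open ≈-Reasoning

  ⊙-cong : ∀ {p p′ q q′} → p ≋ p′ → q ≋ q′ → p ⊙ q ≋ p′ ⊙ q′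
  ⊙-cong p≋p′ q≋q′ zero    = *-cong (p≋p′ 0) (q≋q′ 0)
  ⊙-cong p≋p′ q≋q′ (suc n) = +-cong (*-cong (p≋p′ 0) (q≋q′ (suc n))) (⊙-cong (p≋p′ ∘ suc) q≋q′ n)

  ⊙-identityˡ : ∀ p → 𝟙 ⊙ p ≋ p
  ⊙-identityˡ p n = trans (const-⊙ 1# p n) (*-identityˡ _)

  powerSeriesRing : CommutativeRing c ℓ
  powerSeriesRing = record
    { Carrier = Series
    ; _≈_ = _≋_
    ; _+_ = _⊕_
    ; _*_ = _⊙_
    ; -_ = ⊝_
    ; 0# = 𝟘
    ; 1# = 𝟙
    ; isCommutativeRing = record
      { isRing = record
        { +-isAbelianGroup = record
          { isGroup = record
            { isMonoid = record
              { isSemigroup = record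
                { isMagma = record
                  { isEquivalence = record
                    { refl = λ n → refl ; sym = λ p≋q n → sym (p≋q n) ; trans = λ p≋q q≋r n → trans (p≋q n) (q≋r n) }
                  ; ∙-cong = λ p≋p′ q≋q′ n → +-cong (p≋p′ n) (q≋q′ n) }
                ; assoc = λ p q r n → +-assoc (p n) (q n) (r n) }
              ; identity = (λ p n → +-identityˡ (p n)) , (λ p n → +-identityʳ (p n)) }
            ; inverse = (λ p n → -‿inverseˡ (p n)) , (λ p n → -‿inverseʳ (p n))
            ; ⁻¹-cong = λ p≋q n → -‿cong (p≋q n) }
          ; comm = λ p q n → +-comm (p n) (q n) }
        ; *-cong = ⊙-cong
        ; *-assoc = ⊙-assoc
        ; *-identity = ⊙-identityˡ , (λ p n → trans (⊙-comm p 𝟙 n) (⊙-identityˡ p n))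
        ; distrib = ⊙-distribˡ , ⊙-distribʳ }
      ; *-comm = ⊙-comm } }

  module 𝕊 = CommutativeRing powerSeriesRing
  module Σˢ = Summation powerSeriesRing
  module ≋-Reasoning = SetoidReasoning 𝕊.setoid
  module SeriesSolver = NaturalCoefficients 𝕊.commutativeSemiring
  open import Algebra.Properties.CommutativeSemiring.Exp 𝕊.commutativeSemiring public
    using () renaming (_^_ to infixr 8 _^ˢ_; ^-congˡ to ^ˢ-congˡ; ^-homo-* to ^ˢ-homo-⊙; ^-distrib-* to ^ˢ-distrib-⊙)

  open import Algebra.Properties.Semiring.Mult 𝕊.semiring using () renaming (_×_ to _×ˢ_)

  ×ˢ-coeff : ∀ m p n → (m ×ˢ p) n ≈ ℕ→R R m * p n
  ×ˢ-coeff zero    p n = sym (zeroˡ (p n))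
  ×ˢ-coeff (suc m) p n = begin
    p n + (m ×ˢ p) n             ≈⟨ +-cong (sym (*-identityˡ (p n))) (×ˢ-coeff m p n) ⟩
    1# * p n + ℕ→R R m * p n     ≈⟨ distribʳ (p n) 1# (ℕ→R R m) ⟨
    (1# + ℕ→R R m) * p n         ∎
    where open ≈-Reasoning

  Σˢ-coeff : ∀ N (F : ℕ → Series) n → Σˢ.Σ N F n ≈ Σ N (λ i → F i n)
  Σˢ-coeff zero    F n = refl
  Σˢ-coeff (suc N) F n = +-congʳ (Σˢ-coeff N F n)

  const-cong : ∀ {x y} → x ≈ y → const x ≋ const y
  const-cong x≈y zero    = x≈y
  const-cong x≈y (suc n) = refl

  const-+ : ∀ x y → const (x + y) ≋ const x ⊕ const y
  const-+ x y zero    = refl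
  const-+ x y (suc n) = sym (+-identityʳ 0#)

  const-* : ∀ x y → const (x * y) ≋ const x ⊙ const y
  const-* x y zero    = refl
  const-* x y (suc n) = sym (trans (const-⊙ x (const y) (suc n)) (zeroʳ x))

  const-⊙-^ˢ : ∀ x p j n → ((const x ⊙ p) ^ˢ j) n ≈ x ^ j * (p ^ˢ j) n
  const-⊙-^ˢ x p j n = trans (^ˢ-distrib-⊙ (const x) p j n) (trans (⊙-cong (const-^ˢ j) 𝕊.refl n) (const-⊙ _ _ n))
    where
    const-^ˢ : ∀ j → const x ^ˢ j ≋ const (x ^ j)
    const-^ˢ zero    = 𝕊.refl
    const-^ˢ (suc j) = 𝕊.trans (𝕊.*-congˡ (const-^ˢ j)) (𝕊.sym (const-* x (x ^ j)))

  𝟙^ˢ : ∀ n → 𝟙 ^ˢ n ≋ 𝟙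
  𝟙^ˢ zero    = 𝕊.refl
  𝟙^ˢ (suc n) = 𝕊.trans (𝕊.*-congˡ (𝟙^ˢ n)) (𝕊.*-identityˡ 𝟙)

  t : Series
  t zero    = 0#
  t (suc n) = 𝟙 n

  t-⊙-zero : ∀ p → (t ⊙ p) 0 ≈ 0#
  t-⊙-zero p = zeroˡ _

  t-⊙-suc : ∀ p n → (t ⊙ p) (suc n) ≈ p n
  t-⊙-suc p n = trans (+-congʳ (zeroˡ _)) (trans (+-identityˡ _) (⊙-identityˡ p n))

  t-⊙-shift : ∀ p → p 0 ≈ 0# → p ≋ t ⊙ shift p
  t-⊙-shift p p₀≈0 zero    = trans p₀≈0 (sym (t-⊙-zero (shift p)))
  t-⊙-shift p p₀≈0 (suc n) = sym (t-⊙-suc (shift p) n)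

  t^ˢ-⊙-below : ∀ k p i → i ℕ.< k → (t ^ˢ k ⊙ p) i ≈ 0#
  t^ˢ-⊙-below (suc k) p zero    _         = trans (𝕊.*-assoc t (t ^ˢ k) p 0) (t-⊙-zero (t ^ˢ k ⊙ p))
  t^ˢ-⊙-below (suc k) p (suc i) (s≤s i<k) = trans (𝕊.*-assoc t (t ^ˢ k) p (suc i)) (trans (t-⊙-suc _ i) (t^ˢ-⊙-below k p i i<k))

  t^ˢ-⊙-shift : ∀ k p r → (t ^ˢ k ⊙ p) (k ℕ.+ r) ≈ p r
  t^ˢ-⊙-shift zero    p r = ⊙-identityˡ p r
  t^ˢ-⊙-shift (suc k) p r = trans (𝕊.*-assoc t (t ^ˢ k) p (suc k ℕ.+ r)) (trans (t-⊙-suc _ (k ℕ.+ r)) (t^ˢ-⊙-shift k p r))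

  ^ˢ-factor-t : ∀ p → p 0 ≈ 0# → ∀ k → p ^ˢ k ≋ t ^ˢ k ⊙ shift p ^ˢ k
  ^ˢ-factor-t p p₀≈0 k = 𝕊.trans (^ˢ-congˡ k (t-⊙-shift p p₀≈0)) (^ˢ-distrib-⊙ t (shift p) k)

  ^ˢ-below : ∀ p → p 0 ≈ 0# → ∀ k i → i ℕ.< k → (p ^ˢ k) i ≈ 0#
  ^ˢ-below p p₀≈0 k i i<k = trans (^ˢ-factor-t p p₀≈0 k i) (t^ˢ-⊙-below k _ i i<k)

  ^ˢ-shift : ∀ p → p 0 ≈ 0# → ∀ k r → (p ^ˢ k) (k ℕ.+ r) ≈ (shift p ^ˢ k) r
  ^ˢ-shift p p₀≈0 k r = trans (^ˢ-factor-t p p₀≈0 k (k ℕ.+ r)) (t^ˢ-⊙-shift k _ r)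

  infix 4 _≈[_]_
  _≈[_]_ : Series → ℕ → Series → Set ℓ
  p ≈[ N ] q = ∀ i → i ℕ.< N → p i ≈ q i

  ≈[]-refl : ∀ {p N} → p ≈[ N ] p
  ≈[]-refl i _ = refl

  truncatedSetoid : ℕ → Setoid c ℓ
  truncatedSetoid N = record
    { Carrier       = Series
    ; _≈_           = _≈[ N ]_
    ; isEquivalence = record
      { refl  = ≈[]-refl
      ; sym   = λ p≈q i i<N → sym (p≈q i i<N)
      ; trans = λ p≈q q≈r i i<N → trans (p≈q i i<N) (q≈r i i<N) } }

  module ≈[]-Reasoning (N : ℕ) = SetoidReasoning (truncatedSetoid N)

  ≋⇒≈[] : ∀ {p q N} → p ≋ q → p ≈[ N ] q
  ≋⇒≈[] p≋q i _ = p≋q i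

  ≈[]-mono : ∀ {p q M N} → M ≤ N → p ≈[ N ] q → p ≈[ M ] q
  ≈[]-mono M≤N p≈q i i<M = p≈q i (ℕₚ.<-≤-trans i<M M≤N)

  ⊕-cong[] : ∀ {p p′ q q′ N} → p ≈[ N ] p′ → q ≈[ N ] q′ → p ⊕ q ≈[ N ] p′ ⊕ q′
  ⊕-cong[] p≈p′ q≈q′ i i<N = +-cong (p≈p′ i i<N) (q≈q′ i i<N)

  ⊙-cong[] : ∀ {p p′ q q′ N} → p ≈[ N ] p′ → q ≈[ N ] q′ → p ⊙ q ≈[ N ] p′ ⊙ q′
  ⊙-cong[] {p} {p′} {q} {q′} p≈p′ q≈q′ i i<N = begin
    (p ⊙ q) i                           ≈⟨ cauchy-Σ i p q ⟩
    Σ (suc i) (λ j → p j * q (i ∸ j))   ≈⟨ Σ-cong< (suc i) (λ j j≤i → *-cong (p≈p′ j (ℕₚ.<-≤-trans j≤i i<N))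
                                                                       (q≈q′ (i ∸ j) (ℕₚ.≤-<-trans (ℕₚ.m∸n≤m i j) i<N))) ⟩
    Σ (suc i) (λ j → p′ j * q′ (i ∸ j)) ≈⟨ cauchy-Σ i p′ q′ ⟨
    (p′ ⊙ q′) i                         ∎
    where open ≈-Reasoning

  t-⊙-cong[] : ∀ {p q N} → p ≈[ N ] q → t ⊙ p ≈[ suc N ] t ⊙ q
  t-⊙-cong[] {p} {q} p≈q zero    _         = trans (t-⊙-zero p) (sym (t-⊙-zero q))
  t-⊙-cong[] {p} {q} p≈q (suc i) (s≤s i<N) = trans (t-⊙-suc p i) (trans (p≈q i i<N) (sym (t-⊙-suc q i)))

  ⊙-cong[]-suc : ∀ {e p q N} → e 0 ≈ 0# → p ≈[ N ] q → e ⊙ p ≈[ suc N ] e ⊙ q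
  ⊙-cong[]-suc {e} {p} {q} {N} e₀≈0 p≈q = begin
    e ⊙ p             ≈⟨ ≋⇒≈[] (⊙-cong (t-⊙-shift e e₀≈0) 𝕊.refl) ⟩
    t ⊙ shift e ⊙ p   ≈⟨ ≋⇒≈[] (⊙-assoc t (shift e) p) ⟩
    t ⊙ (shift e ⊙ p) ≈⟨ t-⊙-cong[] (⊙-cong[] ≈[]-refl p≈q) ⟩
    t ⊙ (shift e ⊙ q) ≈⟨ ≋⇒≈[] (⊙-assoc t (shift e) q) ⟨
    t ⊙ shift e ⊙ q   ≈⟨ ≋⇒≈[] (⊙-cong (t-⊙-shift e e₀≈0) 𝕊.refl) ⟨
    e ⊙ q             ∎
    where open ≈[]-Reasoning (suc N)

  -- The Euler operator t·d/dt, used because its Leibniz rule has no boundary terms.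
  θ : Series → Series
  θ p n = ℕ→R R n * p n

  ∂ : Series → Series
  ∂ p = shift (θ p)

  θ-⊙ : ∀ p q → θ (p ⊙ q) ≋ θ p ⊙ q ⊕ p ⊙ θ q
  θ-⊙ p q n = begin
    ℕ→R R n * (p ⊙ q) n
      ≈⟨ *-congˡ (cauchy-Σ n p q) ⟩
    ℕ→R R n * Σ (suc n) (λ i → p i * q (n ∸ i))
      ≈⟨ *-distribˡ-Σ (suc n) _ _ ⟩
    Σ (suc n) (λ i → ℕ→R R n * (p i * q (n ∸ i)))
      ≈⟨ Σ-cong< (suc n) (λ i i≤n → split i (ℕₚ.≤-pred i≤n)) ⟩
    Σ (suc n) (λ i → θ p i * q (n ∸ i) + p i * θ q (n ∸ i))
      ≈⟨ Σ-distrib-+ (suc n) _ _ ⟩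
    Σ (suc n) (λ i → θ p i * q (n ∸ i)) + Σ (suc n) (λ i → p i * θ q (n ∸ i))
      ≈⟨ +-cong (cauchy-Σ n (θ p) q) (cauchy-Σ n p (θ q)) ⟨
    (θ p ⊙ q ⊕ p ⊙ θ q) n ∎
    where
    open ≈-Reasoning
    split : ∀ i → i ≤ n → ℕ→R R n * (p i * q (n ∸ i)) ≈ θ p i * q (n ∸ i) + p i * θ q (n ∸ i)
    split i i≤n = begin
      ℕ→R R n * (p i * q (n ∸ i))
        ≡⟨ cong (λ m → ℕ→R R m * (p i * q (n ∸ i))) (ℕₚ.m+[n∸m]≡n i≤n) ⟨
      ℕ→R R (i ℕ.+ (n ∸ i)) * (p i * q (n ∸ i))
        ≈⟨ *-congʳ (ℕ→R-+ i (n ∸ i)) ⟩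
      (ℕ→R R i + ℕ→R R (n ∸ i)) * (p i * q (n ∸ i))
        ≈⟨ distribʳ _ _ _ ⟩
      ℕ→R R i * (p i * q (n ∸ i)) + ℕ→R R (n ∸ i) * (p i * q (n ∸ i))
        ≈⟨ +-cong (*-assoc _ _ _) (x∙yz≈y∙xz _ _ _) ⟨
      θ p i * q (n ∸ i) + p i * θ q (n ∸ i) ∎

  θ≋t⊙∂ : ∀ p → θ p ≋ t ⊙ ∂ p
  θ≋t⊙∂ p zero    = trans (zeroˡ (p 0)) (sym (t-⊙-zero (∂ p)))
  θ≋t⊙∂ p (suc n) = sym (t-⊙-suc (∂ p) n)

  θ-⊙-suc : ∀ p q n → (θ p ⊙ q) (suc n) ≈ (∂ p ⊙ q) n
  θ-⊙-suc p q n = trans (⊙-cong (θ≋t⊙∂ p) 𝕊.refl (suc n)) (trans (⊙-assoc t (∂ p) q (suc n)) (t-⊙-suc _ n))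

  ∂-⊙ : ∀ p q → ∂ (p ⊙ q) ≋ ∂ p ⊙ q ⊕ p ⊙ ∂ q
  ∂-⊙ p q n = begin
    θ (p ⊙ q) (suc n)                      ≈⟨ θ-⊙ p q (suc n) ⟩
    (θ p ⊙ q) (suc n) + (p ⊙ θ q) (suc n)  ≈⟨ +-congˡ (⊙-comm p (θ q) (suc n)) ⟩
    (θ p ⊙ q) (suc n) + (θ q ⊙ p) (suc n)  ≈⟨ +-cong (θ-⊙-suc p q n) (θ-⊙-suc q p n) ⟩
    (∂ p ⊙ q) n + (∂ q ⊙ p) n              ≈⟨ +-congˡ (⊙-comm (∂ q) p n) ⟩
    (∂ p ⊙ q ⊕ p ⊙ ∂ q) n                  ∎
    where open ≈-Reasoning

  ∂-cong : ∀ {p q} → p ≋ q → ∂ p ≋ ∂ q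
  ∂-cong p≋q n = *-congˡ (p≋q (suc n))

  ∂-cong[] : ∀ {p q N} → p ≈[ suc N ] q → ∂ p ≈[ N ] ∂ q
  ∂-cong[] p≈q i i<N = *-congˡ (p≈q (suc i) (s≤s i<N))

  ∂-⊕ : ∀ p q → ∂ (p ⊕ q) ≋ ∂ p ⊕ ∂ q
  ∂-⊕ p q n = distribˡ _ _ _

  ∂-const : ∀ x → ∂ (const x) ≋ 𝟘
  ∂-const x n = zeroʳ _

  ∂-const-⊙ : ∀ x p → ∂ (const x ⊙ p) ≋ const x ⊙ ∂ p
  ∂-const-⊙ x p n = begin
    ℕ→R R (suc n) * (const x ⊙ p) (suc n) ≈⟨ *-congˡ (const-⊙ x p (suc n)) ⟩
    ℕ→R R (suc n) * (x * p (suc n))       ≈⟨ x∙yz≈y∙xz _ _ _ ⟩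
    x * ∂ p n                             ≈⟨ const-⊙ x (∂ p) n ⟨
    (const x ⊙ ∂ p) n                     ∎
    where open ≈-Reasoning

  ∂-Σ : ∀ N (F : ℕ → Series) → ∂ (Σˢ.Σ N F) ≋ Σˢ.Σ N (λ i → ∂ (F i))
  ∂-Σ zero    F n = zeroʳ _
  ∂-Σ (suc N) F n = trans (∂-⊕ (Σˢ.Σ N F) (F N) n) (+-congʳ (∂-Σ N F n))

  ∂-t : ∂ t ≋ 𝟙
  ∂-t zero    = trans (*-identityʳ _) ℕ→R-1
  ∂-t (suc n) = zeroʳ _

  ∂-^ˢ : ∀ p m → ∂ (p ^ˢ suc m) ≋ const (ℕ→R R (suc m)) ⊙ (p ^ˢ m ⊙ ∂ p)
  ∂-^ˢ p zero = begin
    ∂ (p ⊙ 𝟙)                  ≈⟨ ∂-cong (𝕊.*-identityʳ p) ⟩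
    ∂ p                         ≈⟨ 𝕊.*-identityˡ (∂ p) ⟨
    𝟙 ⊙ ∂ p                     ≈⟨ ⊙-cong (const-cong ℕ→R-1) (𝕊.*-identityˡ (∂ p)) ⟨
    const (ℕ→R R 1) ⊙ (𝟙 ⊙ ∂ p) ∎
    where open ≋-Reasoning
  ∂-^ˢ p (suc m) = begin
    ∂ (p ⊙ p ^ˢ suc m)
      ≈⟨ ∂-⊙ p (p ^ˢ suc m) ⟩
    ∂ p ⊙ p ^ˢ suc m ⊕ p ⊙ ∂ (p ^ˢ suc m)
      ≈⟨ 𝕊.+-congˡ (𝕊.*-congˡ (∂-^ˢ p m)) ⟩
    ∂ p ⊙ (p ⊙ p ^ˢ m) ⊕ p ⊙ (K ⊙ (p ^ˢ m ⊙ ∂ p))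
      ≈⟨ rearrange (∂ p) p (p ^ˢ m) K ⟩
    (𝟙 ⊕ K) ⊙ (p ⊙ p ^ˢ m ⊙ ∂ p)
      ≈⟨ ⊙-cong (const-+ 1# (ℕ→R R (suc m))) 𝕊.refl ⟨
    const (ℕ→R R (suc (suc m))) ⊙ (p ^ˢ suc m ⊙ ∂ p) ∎
    where
    open ≋-Reasoning
    K = const (ℕ→R R (suc m))
    rearrange : ∀ d p a k → d ⊙ (p ⊙ a) ⊕ p ⊙ (k ⊙ (a ⊙ d)) ≋ (𝟙 ⊕ k) ⊙ (p ⊙ a ⊙ d)
    rearrange = solve 4 (λ d p a k → d :* (p :* a) :+ p :* (k :* (a :* d)) := (con 1 :+ k) :* (p :* a :* d)) 𝕊.refl
      where open SeriesSolver

  module Composition (E : Series) (E₀≈0 : E 0 ≈ 0#) where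

    partial : ℕ → Series → Series
    partial N P = Σˢ.Σ N (λ k → const (P k) ⊙ E ^ˢ k)

    -- P ∘ E; only the terms k ≤ n of Σ P k Eᵏ reach tⁿ because E has no constant term.
    composite : Series → Series
    composite P n = partial (suc n) P n

    partial-horner : ∀ N P → partial (suc N) P ≋ const (P 0) ⊕ E ⊙ partial N (shift P)
    partial-horner N P = begin
      partial (suc N) P
        ≈⟨ Σˢ.Σ-head N _ ⟩
      const (P 0) ⊙ 𝟙 ⊕ Σˢ.Σ N (λ k → const (P (suc k)) ⊙ (E ⊙ E ^ˢ k))
        ≈⟨ 𝕊.+-cong (𝕊.*-identityʳ _) (Σˢ.Σ-cong N (λ k → x∙yz≈y∙xzˢ _ E _)) ⟩
      const (P 0) ⊕ Σˢ.Σ N (λ k → E ⊙ (const (P (suc k)) ⊙ E ^ˢ k))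
        ≈⟨ 𝕊.+-congˡ (Σˢ.*-distribˡ-Σ N E _) ⟨
      const (P 0) ⊕ E ⊙ partial N (shift P) ∎
      where
      open ≋-Reasoning
      open import Algebra.Properties.CommutativeSemigroup 𝕊.*-commutativeSemigroup using () renaming (x∙yz≈y∙xz to x∙yz≈y∙xzˢ)

    partial-⊕ : ∀ N P Q → partial N (P ⊕ Q) ≋ partial N P ⊕ partial N Q
    partial-⊕ N P Q = 𝕊.trans (Σˢ.Σ-cong N (λ k → 𝕊.trans (⊙-cong (const-+ (P k) (Q k)) 𝕊.refl) (⊙-distribʳ _ _ _)))
                               (Σˢ.Σ-distrib-+ N _ _)

    partial-scale : ∀ N x P → partial N (λ k → x * P k) ≋ const x ⊙ partial N P
    partial-scale N x P = 𝕊.trans (Σˢ.Σ-cong N (λ k → 𝕊.trans (⊙-cong (const-* x (P k)) 𝕊.refl) (⊙-assoc _ _ _)))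
                                   (𝕊.sym (Σˢ.*-distribˡ-Σ N _ _))

    partial-𝟘 : ∀ N → partial N 𝟘 ≋ 𝟘
    partial-𝟘 N = Σˢ.Σ-vanish N _ (λ k _ n → trans (const-⊙ 0# _ n) (zeroˡ _))

    partial-horner-const : ∀ N x → partial (suc N) (const x) ≋ const x
    partial-horner-const N x = begin
      partial (suc N) (const x)    ≈⟨ partial-horner N (const x) ⟩
      const x ⊕ E ⊙ partial N 𝟘    ≈⟨ 𝕊.+-congˡ (𝕊.*-congˡ (partial-𝟘 N)) ⟩
      const x ⊕ E ⊙ 𝟘              ≈⟨ 𝕊.+-congˡ (𝕊.zeroʳ E) ⟩
      const x ⊕ 𝟘                  ≈⟨ 𝕊.+-identityʳ (const x) ⟩
      const x                      ∎
      where open ≋-Reasoning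

    partial-suc : ∀ N P → partial (suc N) P ≈[ N ] partial N P
    partial-suc N P i i<N = begin
      partial N P i + (const (P N) ⊙ E ^ˢ N) i ≈⟨ +-congˡ (const-⊙ (P N) (E ^ˢ N) i) ⟩
      partial N P i + P N * (E ^ˢ N) i         ≈⟨ +-congˡ (*-congˡ (^ˢ-below E E₀≈0 N i i<N)) ⟩
      partial N P i + P N * 0#                 ≈⟨ +-congˡ (zeroʳ _) ⟩
      partial N P i + 0#                       ≈⟨ +-identityʳ _ ⟩
      partial N P i                            ∎
      where open ≈-Reasoning

    partial-stable : ∀ N o P → partial (N ℕ.+ o) P ≈[ N ] partial N P
    partial-stable N zero    P rewrite ℕₚ.+-identityʳ N = ≈[]-refl
    partial-stable N (suc o) P rewrite ℕₚ.+-suc N o = begin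
      partial (suc (N ℕ.+ o)) P ≈⟨ ≈[]-mono (ℕₚ.m≤m+n N o) (partial-suc (N ℕ.+ o) P) ⟩
      partial (N ℕ.+ o) P       ≈⟨ partial-stable N o P ⟩
      partial N P               ∎
      where open ≈[]-Reasoning N

    partial≈composite : ∀ N P → partial N P ≈[ N ] composite P
    partial≈composite N P i i<N with ℕₚ.m≤n⇒∃[o]m+o≡n i<N
    ... | o , ≡.refl = partial-stable (suc i) o P i ℕₚ.≤-refl

    partial-⊙ : ∀ N P Q → partial N (P ⊙ Q) ≈[ N ] partial N P ⊙ partial N Q
    partial-⊙ zero    P Q i ()
    partial-⊙ (suc N) P Q = begin
      partial (suc N) (P ⊙ Q)
        ≈⟨ ≋⇒≈[] (partial-horner N (P ⊙ Q)) ⟩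
      const (P 0 * Q 0) ⊕ E ⊙ partial N ((λ k → P 0 * Q (suc k)) ⊕ shift P ⊙ Q)
        ≈⟨ ≋⇒≈[] (𝕊.+-congˡ (𝕊.*-congˡ (𝕊.trans (partial-⊕ N _ _) (𝕊.+-congʳ (partial-scale N (P 0) (shift Q)))))) ⟩
      const (P 0 * Q 0) ⊕ E ⊙ (const (P 0) ⊙ B ⊕ partial N (shift P ⊙ Q))
        ≈⟨ ⊕-cong[] ≈[]-refl (⊙-cong[]-suc E₀≈0 (⊕-cong[] ≈[]-refl (partial-⊙ N (shift P) Q))) ⟩
      const (P 0 * Q 0) ⊕ E ⊙ (const (P 0) ⊙ B ⊕ A ⊙ partial N Q)
        ≈⟨ ⊕-cong[] ≈[]-refl (⊙-cong[]-suc E₀≈0 (⊕-cong[] ≈[]-refl (⊙-cong[] ≈[]-refl (partial-suc N Q)))) ⟨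
      const (P 0 * Q 0) ⊕ E ⊙ (const (P 0) ⊙ B ⊕ A ⊙ partial (suc N) Q)
        ≈⟨ ≋⇒≈[] (𝕊.+-cong (const-* (P 0) (Q 0)) (𝕊.*-congˡ (𝕊.+-congˡ (𝕊.*-congˡ (partial-horner N Q))))) ⟩
      const (P 0) ⊙ const (Q 0) ⊕ E ⊙ (const (P 0) ⊙ B ⊕ A ⊙ (const (Q 0) ⊕ E ⊙ B))
        ≈⟨ ≋⇒≈[] (expand (const (P 0)) (const (Q 0)) E A B) ⟩
      (const (P 0) ⊕ E ⊙ A) ⊙ (const (Q 0) ⊕ E ⊙ B)
        ≈⟨ ≋⇒≈[] (⊙-cong (partial-horner N P) (partial-horner N Q)) ⟨
      partial (suc N) P ⊙ partial (suc N) Q ∎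
      where
      open ≈[]-Reasoning (suc N)
      A = partial N (shift P)
      B = partial N (shift Q)
      expand : ∀ a b e x y → a ⊙ b ⊕ e ⊙ (a ⊙ y ⊕ x ⊙ (b ⊕ e ⊙ y)) ≋ (a ⊕ e ⊙ x) ⊙ (b ⊕ e ⊙ y)
      expand = solve 5 (λ a b e x y → a :* b :+ e :* (a :* y :+ x :* (b :+ e :* y)) := (a :+ e :* x) :* (b :+ e :* y)) 𝕊.refl
        where open SeriesSolver

    composite-⊙ : ∀ P Q → composite (P ⊙ Q) ≋ composite P ⊙ composite Q
    composite-⊙ P Q n = begin
      partial (suc n) (P ⊙ Q) n                   ≈⟨ partial-⊙ (suc n) P Q n ℕₚ.≤-refl ⟩
      (partial (suc n) P ⊙ partial (suc n) Q) n   ≈⟨ ⊙-cong[] (partial≈composite (suc n) P) (partial≈composite (suc n) Q) n ℕₚ.≤-refl ⟩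
      (composite P ⊙ composite Q) n               ∎
      where open ≈-Reasoning

    composite-^ˢ : ∀ P k → composite (P ^ˢ k) ≋ composite P ^ˢ k
    composite-^ˢ P zero    n = partial-horner-const n 1# n
    composite-^ˢ P (suc k) = 𝕊.trans (composite-⊙ P (P ^ˢ k)) (𝕊.*-congˡ (composite-^ˢ P k))

    partial-coeff : ∀ N P n → partial N P n ≈ Σ N (λ k → P k * (E ^ˢ k) n)
    partial-coeff N P n = trans (Σˢ-coeff N _ n) (Σ-cong N (λ k → const-⊙ (P k) _ n))

    ∂-partial : ∀ N P → ∂ (partial N P) ≋ Σˢ.Σ N (λ k → const (P k) ⊙ ∂ (E ^ˢ k))
    ∂-partial N P = 𝕊.trans (∂-Σ N _) (Σˢ.Σ-cong N (λ k → ∂-const-⊙ (P k) _))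

    partial-cong : ∀ N {P Q} → (∀ k → P k ≈ Q k) → partial N P ≋ partial N Q
    partial-cong N P≈Q = Σˢ.Σ-cong N (λ k → ⊙-cong (const-cong (P≈Q k)) 𝕊.refl)

  module Reciprocal (X : Series) (X₀≈1 : X 0 ≈ 1#) where

    s : Series
    s = 𝟙 ⊕ ⊝ X

    s₀≈0 : s 0 ≈ 0#
    s₀≈0 = trans (+-congˡ (-‿cong X₀≈1)) (-‿inverseʳ 1#)

    X⊕s≋𝟙 : X ⊕ s ≋ 𝟙
    X⊕s≋𝟙 n = trans (sym (+-assoc (X n) (𝟙 n) (- X n))) (xyx⁻¹≈y (X n) (𝟙 n))
      where open import Algebra.Properties.AbelianGroup +-abelianGroup using (xyx⁻¹≈y)

    open Composition s s₀≈0

    ones : Series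
    ones _ = 1#

    -- 1/X = 1/(1 - s) = Σ sⁱ
    reciprocal : Series
    reciprocal = composite ones

    geometric-telescope : ∀ M → partial M ones ⊙ X ⊕ s ^ˢ M ≋ 𝟙
    geometric-telescope zero    = 𝕊.trans (𝕊.+-congʳ (𝕊.zeroˡ X)) (𝕊.+-identityˡ 𝟙)
    geometric-telescope (suc M) = begin
      partial (suc M) ones ⊙ X ⊕ s ⊙ s ^ˢ M         ≈⟨ 𝕊.+-congʳ (𝕊.*-congʳ (partial-horner M ones)) ⟩
      (𝟙 ⊕ s ⊙ partial M ones) ⊙ X ⊕ s ⊙ s ^ˢ M     ≈⟨ factor X s (partial M ones) (s ^ˢ M) ⟩
      X ⊕ s ⊙ (partial M ones ⊙ X ⊕ s ^ˢ M)         ≈⟨ 𝕊.+-congˡ (𝕊.*-congˡ (geometric-telescope M)) ⟩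
      X ⊕ s ⊙ 𝟙                                     ≈⟨ 𝕊.+-congˡ (𝕊.*-identityʳ s) ⟩
      X ⊕ s                                         ≈⟨ X⊕s≋𝟙 ⟩
      𝟙                                             ∎
      where
      open ≋-Reasoning
      factor : ∀ x s p r → (𝟙 ⊕ s ⊙ p) ⊙ x ⊕ s ⊙ r ≋ x ⊕ s ⊙ (p ⊙ x ⊕ r)
      factor = solve 4 (λ x s p r → (con 1 :+ s :* p) :* x :+ s :* r := x :+ s :* (p :* x :+ r)) 𝕊.refl
        where open SeriesSolver

    reciprocal-⊙ : reciprocal ⊙ X ≋ 𝟙
    reciprocal-⊙ n = begin
      (reciprocal ⊙ X) n                                   ≈⟨ ⊙-cong[] (partial≈composite (suc n) ones) ≈[]-refl n ℕₚ.≤-refl ⟨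
      (partial (suc n) ones ⊙ X) n                         ≈⟨ +-identityʳ _ ⟨
      (partial (suc n) ones ⊙ X) n + 0#                    ≈⟨ +-congˡ (^ˢ-below s s₀≈0 (suc n) n ℕₚ.≤-refl) ⟨
      (partial (suc n) ones ⊙ X ⊕ s ^ˢ suc n) n            ≈⟨ geometric-telescope (suc n) n ⟩
      𝟙 n                                                  ∎
      where open ≈-Reasoning

    -- The truncation of X⁻ⁿ = (1 - s)⁻ⁿ = Σ (n multichoose i) sⁱ below t^(L+1).
    negativeBinomial : ℕ → ℕ → Series
    negativeBinomial n L = partial (suc L) (λ i → ℕ→R R (multichoose n i))

    negativeBinomial-pascal : ∀ n L → negativeBinomial (suc n) L ≈[ suc L ] s ⊙ negativeBinomial (suc n) L ⊕ negativeBinomial n L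
    negativeBinomial-pascal n L = begin
      A                                     ≈⟨ ≋⇒≈[] (partial-horner L a) ⟩
      𝟙′ ⊕ s ⊙ partial L (shift a)          ≈⟨ ≋⇒≈[] (𝕊.+-congˡ (𝕊.*-congˡ (𝕊.trans (partial-cong L pascal) (partial-⊕ L a (shift d))))) ⟩
      𝟙′ ⊕ s ⊙ (partial L a ⊕ P)            ≈⟨ ⊕-cong[] ≈[]-refl (⊙-cong[]-suc s₀≈0 (⊕-cong[] (partial-suc L a) ≈[]-refl)) ⟨
      𝟙′ ⊕ s ⊙ (A ⊕ P)                      ≈⟨ ≋⇒≈[] (regroup 𝟙′ s A P) ⟩
      s ⊙ A ⊕ (𝟙′ ⊕ s ⊙ P)                  ≈⟨ ≋⇒≈[] (𝕊.+-congˡ (partial-horner L d)) ⟨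
      s ⊙ A ⊕ negativeBinomial n L          ∎
      where
      open ≈[]-Reasoning (suc L)
      a d : ℕ → Carrier
      a i = ℕ→R R (multichoose (suc n) i)
      d i = ℕ→R R (multichoose n i)
      A = partial (suc L) a
      P = partial L (shift d)
      𝟙′ = const (ℕ→R R 1)
      pascal : ∀ i → a (suc i) ≈ a i + d (suc i)
      pascal i = ℕ→R-+ (multichoose (suc n) i) (multichoose n (suc i))
      regroup : ∀ u s a p → u ⊕ s ⊙ (a ⊕ p) ≋ s ⊙ a ⊕ (u ⊕ s ⊙ p)
      regroup = solve 4 (λ u s a p → u :+ s :* (a :+ p) := s :* a :+ (u :+ s :* p)) 𝕊.refl
        where open SeriesSolver

    X⊙negativeBinomial : ∀ n L → X ⊙ negativeBinomial (suc n) L ≈[ suc L ] negativeBinomial n L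
    X⊙negativeBinomial n L i i≤L = +-cancelʳ ((s ⊙ A) i) _ _ (begin
      (X ⊙ A) i + (s ⊙ A) i      ≈⟨ ⊙-distribʳ A X s i ⟨
      ((X ⊕ s) ⊙ A) i            ≈⟨ ⊙-cong X⊕s≋𝟙 𝕊.refl i ⟩
      (𝟙 ⊙ A) i                  ≈⟨ ⊙-identityˡ A i ⟩
      A i                        ≈⟨ negativeBinomial-pascal n L i i≤L ⟩
      (s ⊙ A) i + B i            ≈⟨ +-comm _ _ ⟩
      B i + (s ⊙ A) i            ∎)
      where
      open ≈-Reasoning
      open import Algebra.Properties.Group +-group using () renaming (∙-cancelʳ to +-cancelʳ)
      A = negativeBinomial (suc n) L
      B = negativeBinomial n L

    reciprocal-^ˢ : ∀ n L → reciprocal ^ˢ n ≈[ suc L ] negativeBinomial n L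
    reciprocal-^ˢ zero    L = ≋⇒≈[] (𝕊.sym (begin
      negativeBinomial 0 L                  ≈⟨ partial-cong (suc L) (λ { zero → refl ; (suc k) → refl }) ⟩
      partial (suc L) (const (ℕ→R R 1))     ≈⟨ partial-horner-const L (ℕ→R R 1) ⟩
      const (ℕ→R R 1)                       ≈⟨ const-cong ℕ→R-1 ⟩
      𝟙                                     ∎))
      where open ≋-Reasoning
    reciprocal-^ˢ (suc n) L = begin
      reciprocal ⊙ reciprocal ^ˢ n                          ≈⟨ ⊙-cong[] ≈[]-refl (reciprocal-^ˢ n L) ⟩
      reciprocal ⊙ negativeBinomial n L                     ≈⟨ ⊙-cong[] ≈[]-refl (X⊙negativeBinomial n L) ⟨
      reciprocal ⊙ (X ⊙ negativeBinomial (suc n) L)         ≈⟨ ≋⇒≈[] (⊙-assoc reciprocal X _) ⟨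
      reciprocal ⊙ X ⊙ negativeBinomial (suc n) L           ≈⟨ ≋⇒≈[] (⊙-cong reciprocal-⊙ 𝕊.refl) ⟩
      𝟙 ⊙ negativeBinomial (suc n) L                        ≈⟨ ≋⇒≈[] (⊙-identityˡ _) ⟩
      negativeBinomial (suc n) L                            ∎
      where open ≈[]-Reasoning (suc L)

    s^ˢ-coeff : ∀ i n → (s ^ˢ i) n ≈ Σ (suc i) (λ j → ℕ→R R (i C j) * ((⊝ X) ^ˢ j) n)
    s^ˢ-coeff i n = begin
      (s ^ˢ i) n                        ≈⟨ ^ˢ-congˡ i (𝕊.+-comm 𝟙 (⊝ X)) n ⟩
      ((⊝ X ⊕ 𝟙) ^ˢ i) n                ≈⟨ binomialTheorem i (⊝ X) 𝟙 n ⟩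
      binomialExpansion (⊝ X) 𝟙 i n     ≈⟨ Σˢ.sum≈Σ (suc i) (λ j → (i C j) ×ˢ ((⊝ X) ^ˢ j ⊙ 𝟙 ^ˢ (i ∸ j))) n ⟩
      Σˢ.Σ (suc i) (λ j → (i C j) ×ˢ ((⊝ X) ^ˢ j ⊙ 𝟙 ^ˢ (i ∸ j))) n
                                        ≈⟨ Σˢ-coeff (suc i) _ n ⟩
      Σ (suc i) (λ j → ((i C j) ×ˢ ((⊝ X) ^ˢ j ⊙ 𝟙 ^ˢ (i ∸ j))) n)
        ≈⟨ Σ-cong (suc i) (λ j → trans (×ˢ-coeff (i C j) _ n) (*-congˡ (𝕊.trans (𝕊.*-congˡ (𝟙^ˢ (i ∸ j))) (𝕊.*-identityʳ _) n))) ⟩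
      Σ (suc i) (λ j → ℕ→R R (i C j) * ((⊝ X) ^ˢ j) n) ∎
      where
      open ≈-Reasoning
      open import Algebra.Properties.CommutativeSemiring.Binomial 𝕊.commutativeSemiring
        using (binomialExpansion) renaming (theorem to binomialTheorem)

    negativeBinomial-coeff : ∀ n L → negativeBinomial (suc n) L L ≈
      Σ (suc L) (λ j → ℕ→R R (multichoose (suc n) j) * ℕ→R R (multichoose (2 ℕ.+ n ℕ.+ j) (L ∸ j)) * ((⊝ X) ^ˢ j) L)
    negativeBinomial-coeff n L = begin
      negativeBinomial (suc n) L L
        ≈⟨ partial-coeff (suc L) _ L ⟩
      Σ (suc L) (λ i → m i * (s ^ˢ i) L)
        ≈⟨ Σ-cong< (suc L) (λ i i≤L → *-congˡ (trans (s^ˢ-coeff i L) (extend i (ℕₚ.≤-pred i≤L)))) ⟩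
      Σ (suc L) (λ i → m i * Σ (suc L) (λ j → b i j * w j))
        ≈⟨ Σ-cong (suc L) (λ i → *-distribˡ-Σ (suc L) (m i) _) ⟩
      Σ (suc L) (λ i → Σ (suc L) (λ j → m i * (b i j * w j)))
        ≈⟨ Σ-comm (suc L) (suc L) _ ⟩
      Σ (suc L) (λ j → Σ (suc L) (λ i → m i * (b i j * w j)))
        ≈⟨ Σ-cong (suc L) (λ j → trans (Σ-cong (suc L) (λ i → sym (*-assoc _ _ _))) (sym (*-distribʳ-Σ (suc L) (w j) _))) ⟩
      Σ (suc L) (λ j → Σ (suc L) (λ i → m i * b i j) * w j)
        ≈⟨ Σ-cong< (suc L) (λ j j≤L → *-congʳ (Σ-multichoose-C n j L (ℕₚ.≤-pred j≤L))) ⟩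
      Σ (suc L) (λ j → ℕ→R R (multichoose (suc n) j) * ℕ→R R (multichoose (2 ℕ.+ n ℕ.+ j) (L ∸ j)) * w j) ∎
      where
      open ≈-Reasoning
      m : ℕ → Carrier
      m i = ℕ→R R (multichoose (suc n) i)
      b : ℕ → ℕ → Carrier
      b i j = ℕ→R R (i C j)
      w : ℕ → Carrier
      w j = ((⊝ X) ^ˢ j) L
      extend : ∀ i → i ≤ L → Σ (suc i) (λ j → b i j * w j) ≈ Σ (suc L) (λ j → b i j * w j)
      extend i i≤L = begin
        Σ (suc i) (λ j → b i j * w j)             ≈⟨ Σ-extend (suc i) (L ∸ i) _ beyond ⟨
        Σ (suc i ℕ.+ (L ∸ i)) (λ j → b i j * w j) ≡⟨ cong (λ k → Σ (suc k) (λ j → b i j * w j)) (ℕₚ.m+[n∸m]≡n i≤L) ⟩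
        Σ (suc L) (λ j → b i j * w j)             ∎
        where
        beyond : ∀ r → b i (suc i ℕ.+ r) * w (suc i ℕ.+ r) ≈ 0#
        beyond r = trans (*-congʳ (reflexive (cong (ℕ→R R) (k>n⇒nCk≡0 (ℕₚ.m≤m+n (suc i) r))))) (zeroˡ _)

  module Lagrange (E : Series) (E₀≈0 : E 0 ≈ 0#) (b : Carrier) (E₁*b≈1 : E 1 * b ≈ 1#)
                  (torsion-free : ∀ n x → ℕ→R R (suc n) * x ≈ 0# → x ≈ 0#) where

    open Composition E E₀≈0

    U : Series
    U = shift E

    X : Series
    X = const b ⊙ U

    open Reciprocal X (trans (*-comm b (E 1)) E₁*b≈1) public

    -- t/E = 1/U
    W : Series
    W = const b ⊙ reciprocal

    W⊙U : W ⊙ U ≋ 𝟙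
    W⊙U = 𝕊.trans (⊙-cong (⊙-comm (const b) reciprocal) 𝕊.refl) (𝕊.trans (⊙-assoc reciprocal (const b) U) reciprocal-⊙)

    U^ˢ⊙W^ˢ : ∀ r → U ^ˢ r ⊙ W ^ˢ r ≋ 𝟙
    U^ˢ⊙W^ˢ r = 𝕊.trans (𝕊.sym (^ˢ-distrib-⊙ U W r)) (𝕊.trans (^ˢ-congˡ r (𝕊.trans (⊙-comm U W) W⊙U)) (𝟙^ˢ r))

    ∂E : ∂ E ≋ U ⊕ t ⊙ ∂ U
    ∂E = begin
      ∂ E                     ≈⟨ ∂-cong (t-⊙-shift E E₀≈0) ⟩
      ∂ (t ⊙ U)               ≈⟨ ∂-⊙ t U ⟩
      ∂ t ⊙ U ⊕ t ⊙ ∂ U       ≈⟨ 𝕊.+-congʳ (𝕊.trans (⊙-cong ∂-t 𝕊.refl) (⊙-identityˡ U)) ⟩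
      U ⊕ t ⊙ ∂ U             ∎
      where open ≋-Reasoning

    ∂W : ∂ W ≋ ⊝ (W ⊙ ∂ U ⊙ W)
    ∂W = begin
      ∂ W                    ≈⟨ 𝕊.*-identityʳ (∂ W) ⟨
      ∂ W ⊙ 𝟙                ≈⟨ 𝕊.*-congˡ (𝕊.trans (⊙-comm U W) W⊙U) ⟨
      ∂ W ⊙ (U ⊙ W)          ≈⟨ ⊙-assoc (∂ W) U W ⟨
      ∂ W ⊙ U ⊙ W            ≈⟨ 𝕊.*-congʳ (inverseˡ-unique (∂ W ⊙ U) (W ⊙ ∂ U) ∂[W⊙U]≋𝟘) ⟩
      ⊝ (W ⊙ ∂ U) ⊙ W        ≈⟨ -‿distribˡ-* (W ⊙ ∂ U) W ⟨
      ⊝ (W ⊙ ∂ U ⊙ W)        ∎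
      where
      open ≋-Reasoning
      open import Algebra.Properties.Group 𝕊.+-group using (inverseˡ-unique)
      open import Algebra.Properties.Ring 𝕊.ring using (-‿distribˡ-*)
      ∂[W⊙U]≋𝟘 : ∂ W ⊙ U ⊕ W ⊙ ∂ U ≋ 𝟘
      ∂[W⊙U]≋𝟘 = 𝕊.trans (𝕊.sym (∂-⊙ W U)) (𝕊.trans (∂-cong W⊙U) (∂-const 1#))

    W^ˢ⊙∂E-split : ∀ p → W ^ˢ suc (suc p) ⊙ ∂ E ≋ W ^ˢ suc p ⊕ t ⊙ (W ^ˢ suc (suc p) ⊙ ∂ U)
    W^ˢ⊙∂E-split p = 𝕊.trans (𝕊.*-congˡ ∂E) (𝕊.trans (⊙-distribˡ _ U (t ⊙ ∂ U)) (𝕊.+-cong cancel (x∙yz≈y∙xzˢ _ t (∂ U))))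
      where
      open import Algebra.Properties.CommutativeSemigroup 𝕊.*-commutativeSemigroup
        using () renaming (x∙yz≈y∙xz to x∙yz≈y∙xzˢ; xy∙z≈y∙xz to xy∙z≈y∙xzˢ)
      cancel : W ⊙ W ^ˢ suc p ⊙ U ≋ W ^ˢ suc p
      cancel = 𝕊.trans (xy∙z≈y∙xzˢ W (W ^ˢ suc p) U) (𝕊.trans (𝕊.*-congˡ W⊙U) (𝕊.*-identityʳ _))

    ∂W^ˢ : ∀ p → ∂ (W ^ˢ suc p) ≋ ⊝ (const (ℕ→R R (suc p)) ⊙ (W ^ˢ suc (suc p) ⊙ ∂ U))
    ∂W^ˢ p = begin
      ∂ (W ^ˢ suc p)                                      ≈⟨ ∂-^ˢ W p ⟩
      K ⊙ (W ^ˢ p ⊙ ∂ W)                                  ≈⟨ 𝕊.*-congˡ (𝕊.*-congˡ ∂W) ⟩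
      K ⊙ (W ^ˢ p ⊙ ⊝ (W ⊙ ∂ U ⊙ W))                      ≈⟨ 𝕊.*-congˡ (-‿distribʳ-* _ _) ⟨
      K ⊙ ⊝ (W ^ˢ p ⊙ (W ⊙ ∂ U ⊙ W))                      ≈⟨ -‿distribʳ-* _ _ ⟨
      ⊝ (K ⊙ (W ^ˢ p ⊙ (W ⊙ ∂ U ⊙ W)))                    ≈⟨ 𝕊.-‿cong (𝕊.*-congˡ (regroup (W ^ˢ p) W (∂ U))) ⟩
      ⊝ (K ⊙ (W ^ˢ suc (suc p) ⊙ ∂ U))                    ∎
      where
      open ≋-Reasoning
      open import Algebra.Properties.Ring 𝕊.ring using (-‿distribʳ-*)
      K = const (ℕ→R R (suc p))
      regroup : ∀ w′ w d → w′ ⊙ (w ⊙ d ⊙ w) ≋ w ⊙ (w ⊙ w′) ⊙ d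
      regroup = solve 3 (λ w′ w d → w′ :* (w :* d :* w) := w :* (w :* w′) :* d) 𝕊.refl
        where open SeriesSolver

    -- (p+1)-times the coefficient is [tᵖ] ∂(Wᵖ⁺¹) + (p+1)·[tᵖ] Wᵖ⁺² U′, which cancels by ∂W^ˢ.
    W^ˢ⊙∂E-vanish : ∀ p → (W ^ˢ suc (suc p) ⊙ ∂ E) (suc p) ≈ 0#
    W^ˢ⊙∂E-vanish p = torsion-free p _ (begin
      ℕ→R R (suc p) * (W ^ˢ suc (suc p) ⊙ ∂ E) (suc p)        ≈⟨ *-congˡ (W^ˢ⊙∂E-split p (suc p)) ⟩
      ℕ→R R (suc p) * ((W ^ˢ suc p) (suc p) + (t ⊙ Y) (suc p)) ≈⟨ *-congˡ (+-congˡ (t-⊙-suc Y p)) ⟩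
      ℕ→R R (suc p) * ((W ^ˢ suc p) (suc p) + Y p)            ≈⟨ distribˡ _ _ _ ⟩
      ∂ (W ^ˢ suc p) p + ℕ→R R (suc p) * Y p                  ≈⟨ +-congʳ (trans (∂W^ˢ p p) (-‿cong (const-⊙ _ Y p))) ⟩
      - (ℕ→R R (suc p) * Y p) + ℕ→R R (suc p) * Y p           ≈⟨ -‿inverseˡ _ ⟩
      0#                                                      ∎)
      where
      open ≈-Reasoning
      Y = W ^ˢ suc (suc p) ⊙ ∂ U

    W⊙∂E-constant : (W ⊙ ∂ E) 0 ≈ 1#
    W⊙∂E-constant = begin
      W 0 * ∂ E 0            ≈⟨ *-congˡ (∂E 0) ⟩
      W 0 * (U 0 + (t ⊙ ∂ U) 0) ≈⟨ *-congˡ (+-congˡ (t-⊙-zero (∂ U))) ⟩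
      W 0 * (U 0 + 0#)       ≈⟨ *-congˡ (+-identityʳ _) ⟩
      W 0 * U 0              ≈⟨ W⊙U 0 ⟩
      1#                     ∎
      where open ≈-Reasoning

    ∂E^ˢ⊙W^ˢ : ∀ r p → (∂ (E ^ˢ suc r) ⊙ W ^ˢ suc (r ℕ.+ p)) (r ℕ.+ p) ≈ ℕ→R R (suc r) * (W ^ˢ suc p ⊙ ∂ E) p
    ∂E^ˢ⊙W^ˢ r p = begin
      (∂ (E ^ˢ suc r) ⊙ W ^ˢ suc (r ℕ.+ p)) (r ℕ.+ p)       ≈⟨ ⊙-cong ∂E^ˢ W^ˢ-split (r ℕ.+ p) ⟩
      (K ⊙ (t ^ˢ r ⊙ U ^ˢ r ⊙ ∂ E) ⊙ (W ^ˢ r ⊙ Z)) (r ℕ.+ p) ≈⟨ regroup K (t ^ˢ r) (U ^ˢ r) (∂ E) (W ^ˢ r) Z (r ℕ.+ p) ⟩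
      (K ⊙ (t ^ˢ r ⊙ (U ^ˢ r ⊙ W ^ˢ r ⊙ (Z ⊙ ∂ E)))) (r ℕ.+ p) ≈⟨ const-⊙ _ _ (r ℕ.+ p) ⟩
      ℕ→R R (suc r) * (t ^ˢ r ⊙ (U ^ˢ r ⊙ W ^ˢ r ⊙ (Z ⊙ ∂ E))) (r ℕ.+ p)
        ≈⟨ *-congˡ (⊙-cong[] ≈[]-refl (≋⇒≈[] (𝕊.trans (𝕊.*-congʳ (U^ˢ⊙W^ˢ r)) (𝕊.*-identityˡ _))) (r ℕ.+ p) ℕₚ.≤-refl) ⟩
      ℕ→R R (suc r) * (t ^ˢ r ⊙ (Z ⊙ ∂ E)) (r ℕ.+ p)        ≈⟨ *-congˡ (t^ˢ-⊙-shift r _ p) ⟩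
      ℕ→R R (suc r) * (Z ⊙ ∂ E) p                           ∎
      where
      open ≈-Reasoning
      K = const (ℕ→R R (suc r))
      Z = W ^ˢ suc p
      ∂E^ˢ : ∂ (E ^ˢ suc r) ≋ K ⊙ (t ^ˢ r ⊙ U ^ˢ r ⊙ ∂ E)
      ∂E^ˢ = 𝕊.trans (∂-^ˢ E r) (𝕊.*-congˡ (𝕊.*-congʳ (^ˢ-factor-t E E₀≈0 r)))
      W^ˢ-split : W ^ˢ suc (r ℕ.+ p) ≋ W ^ˢ r ⊙ Z
      W^ˢ-split = 𝕊.trans (𝕊.reflexive (cong (W ^ˢ_) (≡.sym (ℕₚ.+-suc r p)))) (^ˢ-homo-⊙ W r (suc p))
      regroup : ∀ k x u d w z → k ⊙ (x ⊙ u ⊙ d) ⊙ (w ⊙ z) ≋ k ⊙ (x ⊙ (u ⊙ w ⊙ (z ⊙ d)))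
      regroup = solve 6 (λ k x u d w z → k :* (x :* u :* d) :* (w :* z) := k :* (x :* (u :* w :* (z :* d)))) 𝕊.refl
        where open SeriesSolver

    residue-diagonal : ∀ q → (∂ (E ^ˢ suc q) ⊙ W ^ˢ suc q) q ≈ ℕ→R R (suc q)
    residue-diagonal q = begin
      (∂ (E ^ˢ suc q) ⊙ W ^ˢ suc q) q                   ≡⟨ cong (λ m → (∂ (E ^ˢ suc q) ⊙ W ^ˢ suc m) m) (ℕₚ.+-identityʳ q) ⟨
      (∂ (E ^ˢ suc q) ⊙ W ^ˢ suc (q ℕ.+ 0)) (q ℕ.+ 0)   ≈⟨ ∂E^ˢ⊙W^ˢ q 0 ⟩
      ℕ→R R (suc q) * (W ⊙ 𝟙 ⊙ ∂ E) 0                   ≈⟨ *-congˡ (trans (⊙-cong {q = ∂ E} (𝕊.*-identityʳ W) 𝕊.refl 0) W⊙∂E-constant) ⟩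
      ℕ→R R (suc q) * 1#                                ≈⟨ *-identityʳ _ ⟩
      ℕ→R R (suc q)                                     ∎
      where open ≈-Reasoning

    residue-below : ∀ q k → k ≤ q → (∂ (E ^ˢ k) ⊙ W ^ˢ suc q) q ≈ 0#
    residue-below q zero    _   = trans (⊙-cong (∂-const 1#) 𝕊.refl q) (𝟘-⊙ _ q)
    residue-below q (suc r) r<q with ℕₚ.m≤n⇒∃[o]m+o≡n r<q
    ... | o , ≡.refl = begin
      (∂ (E ^ˢ suc r) ⊙ W ^ˢ suc (suc (r ℕ.+ o))) (suc (r ℕ.+ o)) ≡⟨ cong (λ m → (∂ (E ^ˢ suc r) ⊙ W ^ˢ suc m) m) (ℕₚ.+-suc r o) ⟨
      (∂ (E ^ˢ suc r) ⊙ W ^ˢ suc (r ℕ.+ suc o)) (r ℕ.+ suc o)     ≈⟨ ∂E^ˢ⊙W^ˢ r (suc o) ⟩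
      ℕ→R R (suc r) * (W ^ˢ suc (suc o) ⊙ ∂ E) (suc o)            ≈⟨ *-congˡ (W^ˢ⊙∂E-vanish o) ⟩
      ℕ→R R (suc r) * 0#                                          ≈⟨ zeroʳ _ ⟩
      0#                                                          ∎
      where open ≈-Reasoning

    residue : ∀ q P → (∂ (partial (suc (suc q)) P) ⊙ W ^ˢ suc q) q ≈ P (suc q) * ℕ→R R (suc q)
    residue q P = begin
      (∂ (partial M P) ⊙ W ^ˢ suc q) q
        ≈⟨ ⊙-cong (∂-partial M P) 𝕊.refl q ⟩
      (Σˢ.Σ M (λ k → const (P k) ⊙ ∂ (E ^ˢ k)) ⊙ W ^ˢ suc q) q
        ≈⟨ Σˢ.*-distribʳ-Σ M (W ^ˢ suc q) _ q ⟩
      Σˢ.Σ M (λ k → const (P k) ⊙ ∂ (E ^ˢ k) ⊙ W ^ˢ suc q) q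
        ≈⟨ Σˢ-coeff M _ q ⟩
      Σ M (λ k → (const (P k) ⊙ ∂ (E ^ˢ k) ⊙ W ^ˢ suc q) q)
        ≈⟨ Σ-cong M (λ k → trans (⊙-assoc _ _ _ q) (const-⊙ (P k) _ q)) ⟩
      Σ (suc q) (λ k → P k * τ k) + P (suc q) * τ (suc q)
        ≈⟨ +-cong (Σ-vanish (suc q) _ (λ k k≤q → trans (*-congˡ (residue-below q k (ℕₚ.≤-pred k≤q))) (zeroʳ _)))
                  (*-congˡ (residue-diagonal q)) ⟩
      0# + P (suc q) * ℕ→R R (suc q)
        ≈⟨ +-identityˡ _ ⟩
      P (suc q) * ℕ→R R (suc q) ∎
      where
      open ≈-Reasoning
      M = suc (suc q)
      τ : ℕ → Carrier
      τ k = (∂ (E ^ˢ k) ⊙ W ^ˢ suc q) q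

    module _ (G : Series) (G∘E≋t : composite G ≋ t) where

      partial-G^ˢ : ∀ N k → partial N (G ^ˢ k) ≈[ N ] t ^ˢ k
      partial-G^ˢ N k = begin
        partial N (G ^ˢ k)   ≈⟨ partial≈composite N (G ^ˢ k) ⟩
        composite (G ^ˢ k)   ≈⟨ ≋⇒≈[] (composite-^ˢ G k) ⟩
        composite G ^ˢ k     ≈⟨ ≋⇒≈[] (^ˢ-congˡ k G∘E≋t) ⟩
        t ^ˢ k               ∎
        where open ≈[]-Reasoning N

      -- The classical n·[tⁿ] Gᵏ = k·[tⁿ⁻ᵏ] (t/E)ⁿ, at exponent k + 1 and n = k + 1 + L.
      lagrange-inversion : ∀ k L → ℕ→R R (suc (k ℕ.+ L)) * (G ^ˢ suc k) (suc (k ℕ.+ L)) ≈ ℕ→R R (suc k) * (W ^ˢ suc (k ℕ.+ L)) L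
      lagrange-inversion k L = begin
        ℕ→R R (suc q) * (G ^ˢ suc k) (suc q)                 ≈⟨ *-comm _ _ ⟩
        (G ^ˢ suc k) (suc q) * ℕ→R R (suc q)                 ≈⟨ residue q (G ^ˢ suc k) ⟨
        (∂ (partial (suc (suc q)) (G ^ˢ suc k)) ⊙ Wq) q      ≈⟨ ⊙-cong[] (∂-cong[] (partial-G^ˢ (suc (suc q)) (suc k))) ≈[]-refl q ℕₚ.≤-refl ⟩
        (∂ (t ^ˢ suc k) ⊙ Wq) q                              ≈⟨ ⊙-cong (∂-^ˢ t k) 𝕊.refl q ⟩
        (const (ℕ→R R (suc k)) ⊙ (t ^ˢ k ⊙ ∂ t) ⊙ Wq) q      ≈⟨ ⊙-assoc _ _ _ q ⟩
        (const (ℕ→R R (suc k)) ⊙ (t ^ˢ k ⊙ ∂ t ⊙ Wq)) q      ≈⟨ const-⊙ _ _ q ⟩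
        ℕ→R R (suc k) * (t ^ˢ k ⊙ ∂ t ⊙ Wq) q                ≈⟨ *-congˡ (⊙-cong (𝕊.trans (𝕊.*-congˡ ∂-t) (𝕊.*-identityʳ _)) 𝕊.refl q) ⟩
        ℕ→R R (suc k) * (t ^ˢ k ⊙ Wq) (k ℕ.+ L)              ≈⟨ *-congˡ (t^ˢ-⊙-shift k Wq L) ⟩
        ℕ→R R (suc k) * Wq L                                 ∎
        where
        open ≈-Reasoning
        q = k ℕ.+ L
        Wq = W ^ˢ suc q

module ExponentialSeries {c ℓ} (R : CommutativeRing c ℓ) (F : Char0Field R) where
  open CommutativeRing R hiding (zero)
  open Char0Field F
  open Series R F using (EGF; Σ<; pow; _⊛_; one; idS; powS; divPow; _∘S_)
  open Summation R
  open NaturalEmbedding R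
  open PowerSeries R
  open import Algebra.Properties.CommutativeSemiring.Exp commutativeSemiring using (_^_)
  open import Algebra.Properties.CommutativeSemigroup *-commutativeSemigroup using (x∙yz≈y∙xz; xy∙z≈xz∙y; interchange)
  module RingSolver = NaturalCoefficients commutativeSemiring

  Σ<≈Σ : ∀ n f → Σ< n f ≈ Σ n f
  Σ<≈Σ zero    f = refl
  Σ<≈Σ (suc n) f = +-congʳ (Σ<≈Σ n f)

  pow≈^ : ∀ x n → pow x n ≈ x ^ n
  pow≈^ x zero    = refl
  pow≈^ x (suc n) = trans (*-congʳ (pow≈^ x n)) (*-comm _ _)

  inv-cancelˡ : ∀ {x} y → ¬ (x ≈ 0#) → inv x * (x * y) ≈ y
  inv-cancelˡ {x} y x≉0 = begin
    inv x * (x * y)   ≈⟨ *-assoc _ _ _ ⟨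
    (inv x * x) * y   ≈⟨ *-congʳ (trans (*-comm _ _) (inv-ok x x≉0)) ⟩
    1# * y            ≈⟨ *-identityˡ y ⟩
    y                 ∎
    where open ≈-Reasoning

  inv-unique : ∀ {x y} → ¬ (x ≈ 0#) → x * y ≈ 1# → inv x ≈ y
  inv-unique {x} {y} x≉0 x*y≈1 = trans (sym (*-identityʳ _)) (trans (*-congˡ (sym x*y≈1)) (inv-cancelˡ y x≉0))

  torsion-free : ∀ n x → ℕ→R R (suc n) * x ≈ 0# → x ≈ 0#
  torsion-free n x n*x≈0 = trans (sym (inv-cancelˡ x (char0 n))) (trans (*-congˡ n*x≈0) (zeroʳ _))

  fac fac⁻¹ : ℕ → Carrier
  fac n   = ℕ→R R (n !)
  fac⁻¹ n = inv (fac n)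

  fac≉0 : ∀ n → ¬ (fac n ≈ 0#)
  fac≉0 n = nonZero (n !) {{n !≢0}}
    where
    nonZero : ∀ m → .{{ℕ.NonZero m}} → ¬ (ℕ→R R m ≈ 0#)
    nonZero (suc m) = char0 m

  fac*fac⁻¹ : ∀ n → fac n * fac⁻¹ n ≈ 1#
  fac*fac⁻¹ n = inv-ok (fac n) (fac≉0 n)

  fac⁻¹-0 : fac⁻¹ 0 ≈ 1#
  fac⁻¹-0 = inv-unique (fac≉0 0) (trans (*-identityʳ _) ℕ→R-1)

  fac⁻¹-suc : ∀ n → fac⁻¹ (suc n) ≈ inv (ℕ→R R (suc n)) * fac⁻¹ n
  fac⁻¹-suc n = inv-unique (fac≉0 (suc n)) (begin
    fac (suc n) * (inv (ℕ→R R (suc n)) * fac⁻¹ n)                ≈⟨ *-congʳ (ℕ→R-* (suc n) (n !)) ⟩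
    (ℕ→R R (suc n) * fac n) * (inv (ℕ→R R (suc n)) * fac⁻¹ n)    ≈⟨ interchange _ _ _ _ ⟩
    (ℕ→R R (suc n) * inv (ℕ→R R (suc n))) * (fac n * fac⁻¹ n)    ≈⟨ *-cong (inv-ok _ (char0 n)) (fac*fac⁻¹ n) ⟩
    1# * 1#                                                      ≈⟨ *-identityˡ 1# ⟩
    1#                                                           ∎)
    where open ≈-Reasoning

  *-fac⇒*fac⁻¹ : ∀ n {x y} → x * fac n ≈ y → x ≈ y * fac⁻¹ n
  *-fac⇒*fac⁻¹ n {x} {y} x*n!≈y = begin
    x                          ≈⟨ *-identityʳ x ⟨
    x * 1#                     ≈⟨ *-congˡ (fac*fac⁻¹ n) ⟨
    x * (fac n * fac⁻¹ n)      ≈⟨ *-assoc _ _ _ ⟨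
    (x * fac n) * fac⁻¹ n      ≈⟨ *-congʳ x*n!≈y ⟩
    y * fac⁻¹ n                ∎
    where open ≈-Reasoning

  C*fac⁻¹ : ∀ {n i} → i ≤ n → ℕ→R R (n C i) * fac⁻¹ n ≈ fac⁻¹ i * fac⁻¹ (n ∸ i)
  C*fac⁻¹ {n} {i} i≤n = ≡.subst (λ m → ℕ→R R (m C i) * fac⁻¹ m ≈ fac⁻¹ i * fac⁻¹ (n ∸ i)) (ℕₚ.m+[n∸m]≡n i≤n) (C+*fac⁻¹ i (n ∸ i))
    where
    C+*fac⁻¹ : ∀ a b → ℕ→R R ((a ℕ.+ b) C a) * fac⁻¹ (a ℕ.+ b) ≈ fac⁻¹ a * fac⁻¹ b
    C+*fac⁻¹ a b = begin
      ℕ→R R ((a ℕ.+ b) C a) * fac⁻¹ (a ℕ.+ b)                      ≈⟨ *-congʳ C≈ ⟩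
      ((fac (a ℕ.+ b) * fac⁻¹ a) * fac⁻¹ b) * fac⁻¹ (a ℕ.+ b)      ≈⟨ regroup _ _ _ _ ⟩
      (fac (a ℕ.+ b) * fac⁻¹ (a ℕ.+ b)) * (fac⁻¹ a * fac⁻¹ b)      ≈⟨ *-congʳ (fac*fac⁻¹ (a ℕ.+ b)) ⟩
      1# * (fac⁻¹ a * fac⁻¹ b)                                     ≈⟨ *-identityˡ _ ⟩
      fac⁻¹ a * fac⁻¹ b                                            ∎
      where
      open ≈-Reasoning
      C≈ : ℕ→R R ((a ℕ.+ b) C a) ≈ (fac (a ℕ.+ b) * fac⁻¹ a) * fac⁻¹ b
      C≈ = *-fac⇒*fac⁻¹ b (*-fac⇒*fac⁻¹ a (begin
        ℕ→R R ((a ℕ.+ b) C a) * fac b * fac a        ≈⟨ trans (*-assoc _ _ _) (*-congˡ (*-comm _ _)) ⟩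
        ℕ→R R ((a ℕ.+ b) C a) * (fac a * fac b)      ≈⟨ trans (ℕ→R-* ((a ℕ.+ b) C a) _) (*-congˡ (ℕ→R-* (a !) (b !))) ⟨
        ℕ→R R (((a ℕ.+ b) C a) ℕ.* (a ! ℕ.* b !))    ≡⟨ cong (ℕ→R R) (C-factorial a b) ⟩
        fac (a ℕ.+ b)                                ∎))
      regroup : ∀ x y z w → ((x * y) * z) * w ≈ (x * w) * (y * z)
      regroup = solve 4 (λ x y z w → ((x :* y) :* z) :* w := (x :* w) :* (y :* z)) refl
        where open RingSolver

  ordinary : EGF → Series
  ordinary a n = a n * fac⁻¹ n

  fac*ordinary : ∀ a n → fac n * ordinary a n ≈ a n
  fac*ordinary a n = trans (x∙yz≈y∙xz _ _ _) (trans (*-congˡ (fac*fac⁻¹ n)) (*-identityʳ _))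

  ordinary-⊛ : ∀ a b → ordinary (a ⊛ b) ≋ ordinary a ⊙ ordinary b
  ordinary-⊛ a b n = begin
    Σ< (suc n) (λ i → ℕ→R R (n C i) * (a i * b (n ∸ i))) * fac⁻¹ n   ≈⟨ *-congʳ (Σ<≈Σ (suc n) _) ⟩
    Σ (suc n) (λ i → ℕ→R R (n C i) * (a i * b (n ∸ i))) * fac⁻¹ n    ≈⟨ *-distribʳ-Σ (suc n) _ _ ⟩
    Σ (suc n) (λ i → ℕ→R R (n C i) * (a i * b (n ∸ i)) * fac⁻¹ n)    ≈⟨ Σ-cong< (suc n) (λ i i≤n → term i (ℕₚ.≤-pred i≤n)) ⟩
    Σ (suc n) (λ i → ordinary a i * ordinary b (n ∸ i))              ≈⟨ cauchy-Σ n (ordinary a) (ordinary b) ⟨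
    (ordinary a ⊙ ordinary b) n                                      ∎
    where
    open ≈-Reasoning
    term : ∀ i → i ≤ n → ℕ→R R (n C i) * (a i * b (n ∸ i)) * fac⁻¹ n ≈ ordinary a i * ordinary b (n ∸ i)
    term i i≤n = begin
      ℕ→R R (n C i) * (a i * b (n ∸ i)) * fac⁻¹ n       ≈⟨ xy∙z≈xz∙y _ _ _ ⟩
      ℕ→R R (n C i) * fac⁻¹ n * (a i * b (n ∸ i))       ≈⟨ *-congʳ (C*fac⁻¹ i≤n) ⟩
      fac⁻¹ i * fac⁻¹ (n ∸ i) * (a i * b (n ∸ i))       ≈⟨ interchange _ _ _ _ ⟩
      fac⁻¹ i * a i * (fac⁻¹ (n ∸ i) * b (n ∸ i))       ≈⟨ *-cong (*-comm _ _) (*-comm _ _) ⟩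
      ordinary a i * ordinary b (n ∸ i)                 ∎

  ordinary-powS : ∀ a k → ordinary (powS a k) ≋ ordinary a ^ˢ k
  ordinary-powS a zero    zero    = trans (*-identityˡ _) fac⁻¹-0
  ordinary-powS a zero    (suc n) = zeroˡ _
  ordinary-powS a (suc k) = 𝕊.trans (ordinary-⊛ (powS a k) a) (𝕊.trans (⊙-cong (ordinary-powS a k) 𝕊.refl) (⊙-comm _ _))

  ordinary-idS : ordinary idS ≋ t
  ordinary-idS zero          = zeroˡ _
  ordinary-idS (suc zero)    = trans (*-identityˡ _) fac⁻¹-0
  ordinary-idS (suc (suc n)) = zeroˡ _

  composite-ordinary : ∀ g e (e₀≈0 : ordinary e 0 ≈ 0#) → (∀ n → (g ∘S e) n ≈ idS n) →
                       Composition.composite (ordinary e) e₀≈0 (ordinary g) ≋ t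
  composite-ordinary g e e₀≈0 g∘e≈idS n = begin
    composite (ordinary g) n                                        ≈⟨ partial-coeff (suc n) (ordinary g) n ⟩
    Σ (suc n) (λ k → ordinary g k * (ordinary e ^ˢ k) n)            ≈⟨ Σ-cong (suc n) (λ k → *-congˡ (ordinary-powS e k n)) ⟨
    Σ (suc n) (λ k → ordinary g k * (powS e k n * fac⁻¹ n))         ≈⟨ Σ-cong (suc n) (λ k → regroup (g k) (fac⁻¹ k) (powS e k n) (fac⁻¹ n)) ⟩
    Σ (suc n) (λ k → g k * divPow e k n * fac⁻¹ n)                  ≈⟨ *-distribʳ-Σ (suc n) _ _ ⟨
    Σ (suc n) (λ k → g k * divPow e k n) * fac⁻¹ n                  ≈⟨ *-congʳ (trans (sym (Σ<≈Σ (suc n) _)) (g∘e≈idS n)) ⟩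
    ordinary idS n                                                  ≈⟨ ordinary-idS n ⟩
    t n                                                             ∎
    where
    open ≈-Reasoning
    open Composition (ordinary e) e₀≈0 using (composite; partial-coeff)
    regroup : ∀ x y z w → (x * y) * (z * w) ≈ x * (y * z) * w
    regroup = solve 4 (λ x y z w → (x :* y) :* (z :* w) := x :* (y :* z) :* w) refl
      where open RingSolver

module StirlingInversion {c ℓ} (R : CommutativeRing c ℓ) (F : Char0Field R) where
  open CommutativeRing R hiding (zero)
  open Char0Field F
  open Series R F using (EGF; Σ<; pow; sign; powS; idS; _∘S_; eSeries; S₁; S₂)
  open Summation R
  open NaturalEmbedding R
  open PowerSeries R
  open ExponentialSeries R F
  open import Algebra.Properties.CommutativeSemiring.Exp commutativeSemiring using (_^_; ^-homo-*)

  module _ (m : ℕ → Carrier) (m₀≈1 : m 0 ≈ 1#) (m₁≉0 : ¬ (m 1 ≈ 0#))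
           (ebar : EGF) (ebar∘e≈idS : ∀ n → (ebar ∘S eSeries m) n ≈ idS n) where
    E G : Series
    E = ordinary (eSeries m)
    G = ordinary ebar

    b : Carrier
    b = inv (m 1)

    E₀≈0 : E 0 ≈ 0#
    E₀≈0 = trans (*-congʳ (trans (+-congʳ m₀≈1) (-‿inverseʳ 1#))) (zeroˡ _)

    E₁*b≈1 : E 1 * b ≈ 1#
    E₁*b≈1 = trans (*-congʳ (trans (*-congˡ fac⁻¹-0) (*-identityʳ _))) (inv-ok (m 1) m₁≉0)

    open Lagrange E E₀≈0 b E₁*b≈1 torsion-free

    S₁-lagrange : ∀ k L → S₁ ebar (suc (k ℕ.+ L)) (suc k) ≈ fac⁻¹ k * fac (k ℕ.+ L) * (W ^ˢ suc (k ℕ.+ L)) L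
    S₁-lagrange k L = begin
      fac⁻¹ (suc k) * powS ebar (suc k) (suc q)
        ≈⟨ *-cong (fac⁻¹-suc k) (sym (fac*ordinary (powS ebar (suc k)) (suc q))) ⟩
      (i * fac⁻¹ k) * (fac (suc q) * ordinary (powS ebar (suc k)) (suc q))
        ≈⟨ *-congˡ (*-cong (ℕ→R-* (suc q) (q !)) (ordinary-powS ebar (suc k) (suc q))) ⟩
      (i * fac⁻¹ k) * ((ℕ→R R (suc q) * fac q) * (G ^ˢ suc k) (suc q))
        ≈⟨ regroup₁ _ _ _ _ ⟩
      (i * fac⁻¹ k) * (fac q * (ℕ→R R (suc q) * (G ^ˢ suc k) (suc q)))
        ≈⟨ *-congˡ (*-congˡ (lagrange-inversion G (composite-ordinary ebar (eSeries m) E₀≈0 ebar∘e≈idS) k L)) ⟩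
      (i * fac⁻¹ k) * (fac q * (ℕ→R R (suc k) * (W ^ˢ suc q) L))
        ≈⟨ regroup₂ _ _ _ _ _ ⟩
      i * (ℕ→R R (suc k) * (fac⁻¹ k * fac q * (W ^ˢ suc q) L))
        ≈⟨ inv-cancelˡ _ (char0 k) ⟩
      fac⁻¹ k * fac q * (W ^ˢ suc q) L ∎
      where
      open ≈-Reasoning
      q = k ℕ.+ L
      i = inv (ℕ→R R (suc k))
      regroup₁ : ∀ a n f g → a * ((n * f) * g) ≈ a * (f * (n * g))
      regroup₁ = solve 4 (λ a n f g → a :* ((n :* f) :* g) := a :* (f :* (n :* g))) refl
        where open RingSolver
      regroup₂ : ∀ i f g n w → (i * f) * (g * (n * w)) ≈ i * (n * (f * g * w))
      regroup₂ = solve 5 (λ i f g n w → (i :* f) :* (g :* (n :* w)) := i :* (n :* (f :* g :* w))) refl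
        where open RingSolver

    U^ˢ-coeff : ∀ j L → (U ^ˢ j) L ≈ fac j * S₂ m (L ℕ.+ j) j * fac⁻¹ (L ℕ.+ j)
    U^ˢ-coeff j L = begin
      (U ^ˢ j) L                                          ≈⟨ ^ˢ-shift E E₀≈0 j L ⟨
      (E ^ˢ j) (j ℕ.+ L)                                  ≡⟨ cong (E ^ˢ j) (ℕₚ.+-comm j L) ⟩
      (E ^ˢ j) (L ℕ.+ j)                                  ≈⟨ ordinary-powS (eSeries m) j (L ℕ.+ j) ⟨
      powS (eSeries m) j (L ℕ.+ j) * fac⁻¹ (L ℕ.+ j)      ≈⟨ *-congʳ (trans (sym (*-assoc _ _ _)) (trans (*-congʳ (fac*fac⁻¹ j)) (*-identityˡ _))) ⟨
      fac j * S₂ m (L ℕ.+ j) j * fac⁻¹ (L ℕ.+ j)          ∎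
      where open ≈-Reasoning

    ⊝X^ˢ-coeff : ∀ j L → ((⊝ X) ^ˢ j) L ≈ (- 1#) ^ j * (b ^ j * (U ^ˢ j) L)
    ⊝X^ˢ-coeff j L = begin
      ((⊝ X) ^ˢ j) L                  ≈⟨ ^ˢ-congˡ j ⊝X≋-1⊙X L ⟩
      ((const (- 1#) ⊙ X) ^ˢ j) L     ≈⟨ const-⊙-^ˢ (- 1#) X j L ⟩
      (- 1#) ^ j * (X ^ˢ j) L         ≈⟨ *-congˡ (const-⊙-^ˢ b U j L) ⟩
      (- 1#) ^ j * (b ^ j * (U ^ˢ j) L) ∎
      where
      open ≈-Reasoning
      open import Algebra.Properties.Ring ring using (-1*x≈-x)
      ⊝X≋-1⊙X : ⊝ X ≋ const (- 1#) ⊙ X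
      ⊝X≋-1⊙X n = sym (trans (const-⊙ (- 1#) X n) (-1*x≈-x (X n)))

    W^ˢ-coeff : ∀ q L → (W ^ˢ suc q) L ≈
      Σ (suc L) (λ j → ℕ→R R (multichoose (suc q) j) * ℕ→R R (multichoose (2 ℕ.+ q ℕ.+ j) (L ∸ j))
                         * ((- 1#) ^ j * b ^ (suc q ℕ.+ j) * (U ^ˢ j) L))
    W^ˢ-coeff q L = begin
      (W ^ˢ n) L                                             ≈⟨ const-⊙-^ˢ b reciprocal n L ⟩
      b ^ n * (reciprocal ^ˢ n) L                            ≈⟨ *-congˡ (reciprocal-^ˢ n L L ℕₚ.≤-refl) ⟩
      b ^ n * negativeBinomial n L L                         ≈⟨ *-congˡ (negativeBinomial-coeff q L) ⟩
      b ^ n * Σ (suc L) (λ j → κ j * ((⊝ X) ^ˢ j) L)          ≈⟨ *-distribˡ-Σ (suc L) _ _ ⟩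
      Σ (suc L) (λ j → b ^ n * (κ j * ((⊝ X) ^ˢ j) L))        ≈⟨ Σ-cong (suc L) term ⟩
      Σ (suc L) (λ j → κ j * ((- 1#) ^ j * b ^ (n ℕ.+ j) * (U ^ˢ j) L)) ∎
      where
      open ≈-Reasoning
      n = suc q
      κ : ℕ → Carrier
      κ j = ℕ→R R (multichoose n j) * ℕ→R R (multichoose (2 ℕ.+ q ℕ.+ j) (L ∸ j))
      regroup : ∀ x c s y u → x * (c * (s * (y * u))) ≈ c * (s * (x * y) * u)
      regroup = solve 5 (λ x c s y u → x :* (c :* (s :* (y :* u))) := c :* (s :* (x :* y) :* u)) refl
        where open RingSolver
      term : ∀ j → b ^ n * (κ j * ((⊝ X) ^ˢ j) L) ≈ κ j * ((- 1#) ^ j * b ^ (n ℕ.+ j) * (U ^ˢ j) L)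
      term j = begin
        b ^ n * (κ j * ((⊝ X) ^ˢ j) L)                          ≈⟨ *-congˡ (*-congˡ (⊝X^ˢ-coeff j L)) ⟩
        b ^ n * (κ j * ((- 1#) ^ j * (b ^ j * (U ^ˢ j) L)))     ≈⟨ regroup _ _ _ _ _ ⟩
        κ j * ((- 1#) ^ j * (b ^ n * b ^ j) * (U ^ˢ j) L)       ≈⟨ *-congˡ (*-congʳ (*-congˡ (^-homo-* b n j))) ⟨
        κ j * ((- 1#) ^ j * b ^ (n ℕ.+ j) * (U ^ˢ j) L)         ∎

    fac-multichoose : ∀ k L j →
      fac⁻¹ k * fac (k ℕ.+ L) * ℕ→R R (multichoose (suc (k ℕ.+ L)) j) * fac j * fac⁻¹ (L ℕ.+ j) ≈ ℕ→R R ((k ℕ.+ L ℕ.+ j) C (L ℕ.+ j))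
    fac-multichoose k L j = sym (begin
      ℕ→R R Cq                                              ≈⟨ *-fac⇒*fac⁻¹ k (*-fac⇒*fac⁻¹ (L ℕ.+ j) cleared) ⟩
      ℕ→R R M * (fac q * fac j) * fac⁻¹ (L ℕ.+ j) * fac⁻¹ k  ≈⟨ regroup _ _ _ _ _ ⟩
      fac⁻¹ k * fac q * ℕ→R R M * fac j * fac⁻¹ (L ℕ.+ j)    ∎)
      where
      open ≈-Reasoning
      q  = k ℕ.+ L
      Cq = (q ℕ.+ j) C (L ℕ.+ j)
      M  = multichoose (suc q) j
      cleared : ℕ→R R Cq * fac k * fac (L ℕ.+ j) ≈ ℕ→R R M * (fac q * fac j)
      cleared = begin
        ℕ→R R Cq * fac k * fac (L ℕ.+ j)            ≈⟨ trans (*-assoc _ _ _) (*-congˡ (*-comm _ _)) ⟩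
        ℕ→R R Cq * (fac (L ℕ.+ j) * fac k)          ≈⟨ trans (ℕ→R-* Cq _) (*-congˡ (ℕ→R-* ((L ℕ.+ j) !) (k !))) ⟨
        ℕ→R R (Cq ℕ.* ((L ℕ.+ j) ! ℕ.* k !))        ≡⟨ cong (ℕ→R R) (C-multichoose-factorials k L j) ⟩
        ℕ→R R (M ℕ.* (q ! ℕ.* j !))                 ≈⟨ trans (ℕ→R-* M _) (*-congˡ (ℕ→R-* (q !) (j !))) ⟩
        ℕ→R R M * (fac q * fac j)                   ∎
      regroup : ∀ m f g l k → m * (f * g) * l * k ≈ k * f * m * g * l
      regroup = solve 5 (λ m f g l k → m :* (f :* g) :* l :* k := k :* f :* m :* g :* l) refl
        where open RingSolver

    S₁-expansion : ∀ k L → S₁ ebar (suc (k ℕ.+ L)) (suc k) ≈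
      Σ (suc L) (λ j → ℕ→R R ((k ℕ.+ L ℕ.+ j) C (L ℕ.+ j)) * ℕ→R R (multichoose (2 ℕ.+ (k ℕ.+ L) ℕ.+ j) (L ∸ j))
                         * (- 1#) ^ j * b ^ (suc (k ℕ.+ L) ℕ.+ j) * S₂ m (L ℕ.+ j) j)
    S₁-expansion k L = begin
      S₁ ebar (suc q) (suc k)                                               ≈⟨ S₁-lagrange k L ⟩
      fac⁻¹ k * fac q * (W ^ˢ suc q) L                                      ≈⟨ *-congˡ (W^ˢ-coeff q L) ⟩
      fac⁻¹ k * fac q * Σ (suc L) (λ j → A j * B j * (ε j * β j * (U ^ˢ j) L)) ≈⟨ *-distribˡ-Σ (suc L) _ _ ⟩
      Σ (suc L) (λ j → fac⁻¹ k * fac q * (A j * B j * (ε j * β j * (U ^ˢ j) L))) ≈⟨ Σ-cong (suc L) term ⟩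
      Σ (suc L) (λ j → ℕ→R R ((q ℕ.+ j) C (L ℕ.+ j)) * B j * ε j * β j * S₂ m (L ℕ.+ j) j) ∎
      where
      open ≈-Reasoning
      q = k ℕ.+ L
      A B ε β : ℕ → Carrier
      A j = ℕ→R R (multichoose (suc q) j)
      B j = ℕ→R R (multichoose (2 ℕ.+ q ℕ.+ j) (L ∸ j))
      ε j = (- 1#) ^ j
      β j = b ^ (suc q ℕ.+ j)
      regroup : ∀ i f a b s p g S l → i * f * (a * b * (s * p * (g * S * l))) ≈ i * f * a * g * l * b * s * p * S
      regroup = solve 9 (λ i f a b s p g S l → i :* f :* (a :* b :* (s :* p :* (g :* S :* l))) := i :* f :* a :* g :* l :* b :* s :* p :* S) refl
        where open RingSolver
      term : ∀ j → fac⁻¹ k * fac q * (A j * B j * (ε j * β j * (U ^ˢ j) L)) ≈ ℕ→R R ((q ℕ.+ j) C (L ℕ.+ j)) * B j * ε j * β j * S₂ m (L ℕ.+ j) j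
      term j = begin
        fac⁻¹ k * fac q * (A j * B j * (ε j * β j * (U ^ˢ j) L))
          ≈⟨ *-congˡ (*-congˡ (*-congˡ (U^ˢ-coeff j L))) ⟩
        fac⁻¹ k * fac q * (A j * B j * (ε j * β j * (fac j * S₂ m (L ℕ.+ j) j * fac⁻¹ (L ℕ.+ j))))
          ≈⟨ regroup _ _ _ _ _ _ _ _ _ ⟩
        fac⁻¹ k * fac q * A j * fac j * fac⁻¹ (L ℕ.+ j) * B j * ε j * β j * S₂ m (L ℕ.+ j) j
          ≈⟨ *-congʳ (*-congʳ (*-congʳ (*-congʳ (fac-multichoose k L j)))) ⟩
        ℕ→R R ((q ℕ.+ j) C (L ℕ.+ j)) * B j * ε j * β j * S₂ m (L ℕ.+ j) j ∎

    stirlingSum : ℕ → ℕ → Carrier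
    stirlingSum n k =
      Σ< (suc (n ∸ k)) (λ j → ℕ→R R ((n ℕ.+ j ∸ 1) C (n ℕ.+ j ∸ k)) * ℕ→R R ((2 ℕ.* n ∸ k) C (n ∸ k ∸ j))
                                * sign j * pow b (n ℕ.+ j) * S₂ m (n ∸ k ℕ.+ j) j)

    stirlingSum-suc : ∀ k L → stirlingSum (suc (k ℕ.+ L)) (suc k) ≈
      Σ (suc L) (λ j → ℕ→R R ((k ℕ.+ L ℕ.+ j) C (L ℕ.+ j)) * ℕ→R R (multichoose (2 ℕ.+ (k ℕ.+ L) ℕ.+ j) (L ∸ j))
                         * (- 1#) ^ j * b ^ (suc (k ℕ.+ L) ℕ.+ j) * S₂ m (L ℕ.+ j) j)
    stirlingSum-suc k L = begin
      Σ< (suc (q ∸ k)) f   ≈⟨ Σ<≈Σ (suc (q ∸ k)) f ⟩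
      Σ (suc (q ∸ k)) f    ≡⟨ cong (λ a → Σ (suc a) f) q∸k≡L ⟩
      Σ (suc L) f          ≈⟨ Σ-cong< (suc L) (λ j j≤L → term j (ℕₚ.≤-pred j≤L)) ⟩
      Σ (suc L) (λ j → ℕ→R R ((q ℕ.+ j) C (L ℕ.+ j)) * ℕ→R R (multichoose (2 ℕ.+ q ℕ.+ j) (L ∸ j))
                         * (- 1#) ^ j * b ^ (suc q ℕ.+ j) * S₂ m (L ℕ.+ j) j) ∎
      where
      open ≈-Reasoning
      q = k ℕ.+ L
      q∸k≡L : q ∸ k ≡ L
      q∸k≡L = ℕₚ.m+n∸m≡n k L
      f : ℕ → Carrier
      f j = ℕ→R R ((q ℕ.+ j) C (q ℕ.+ j ∸ k)) * ℕ→R R ((2 ℕ.* suc q ∸ suc k) C (q ∸ k ∸ j))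
              * sign j * pow b (suc q ℕ.+ j) * S₂ m (q ∸ k ℕ.+ j) j
      term : ∀ j → j ≤ L → f j ≈ ℕ→R R ((q ℕ.+ j) C (L ℕ.+ j)) * ℕ→R R (multichoose (2 ℕ.+ q ℕ.+ j) (L ∸ j))
                                   * (- 1#) ^ j * b ^ (suc q ℕ.+ j) * S₂ m (L ℕ.+ j) j
      term j j≤L = *-cong (*-cong (*-cong (*-cong
        (reflexive (cong (λ a → ℕ→R R ((q ℕ.+ j) C a)) (≡.trans (cong (_∸ k) (ℕₚ.+-assoc k L j)) (ℕₚ.m+n∸m≡n k (L ℕ.+ j)))))
        (reflexive (cong (ℕ→R R) (≡.trans (cong (λ a → (2 ℕ.* suc q ∸ suc k) C (a ∸ j)) q∸k≡L) (≡.sym (multichoose≡[2n∸k]C[L∸j] k L j j≤L))))))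
        (pow≈^ (- 1#) j))
        (pow≈^ b (suc q ℕ.+ j)))
        (reflexive (cong (λ a → S₂ m (a ℕ.+ j) j) q∸k≡L))

    S₁-diagonal-zero : S₁ ebar 0 0 ≈ stirlingSum 0 0
    S₁-diagonal-zero = sym (begin
      0# + ℕ→R R 1 * ℕ→R R 1 * 1# * 1# * (inv (ℕ→R R 1) * 1#)  ≈⟨ +-identityˡ _ ⟩
      ℕ→R R 1 * ℕ→R R 1 * 1# * 1# * (inv (ℕ→R R 1) * 1#)       ≈⟨ *-congʳ one ⟩
      1# * (inv (ℕ→R R 1) * 1#)                                ≈⟨ *-identityˡ _ ⟩
      inv (ℕ→R R 1) * 1#                                       ∎)
      where
      open ≈-Reasoning
      one : ℕ→R R 1 * ℕ→R R 1 * 1# * 1# ≈ 1#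
      one = trans (*-identityʳ _) (trans (*-identityʳ _) (trans (*-cong ℕ→R-1 ℕ→R-1) (*-identityʳ 1#)))

    S₁-column-zero : ∀ n → S₁ ebar (suc n) 0 ≈ stirlingSum (suc n) 0
    S₁-column-zero n = trans (zeroʳ _) (sym (trans (Σ<≈Σ (suc (suc n)) _) (Σ-vanish (suc (suc n)) _ (λ j _ → vanish j))))
      where
      vanish : ∀ j → ℕ→R R ((n ℕ.+ j) C suc (n ℕ.+ j)) * ℕ→R R ((2 ℕ.* suc n) C (suc n ∸ j))
                       * sign j * pow b (suc n ℕ.+ j) * S₂ m (suc n ℕ.+ j) j ≈ 0#
      vanish j = trans (*-congʳ (*-congʳ (*-congʳ (trans (*-congʳ (reflexive (cong (ℕ→R R) (k>n⇒nCk≡0 (ℕₚ.n<1+n (n ℕ.+ j)))))) (zeroˡ _)))))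
                       (trans (*-congʳ (*-congʳ (zeroˡ _))) (trans (*-congʳ (zeroˡ _)) (zeroˡ _)))

    S₁≈stirlingSum : ∀ n k → k ≤ n → S₁ ebar n k ≈ stirlingSum n k
    S₁≈stirlingSum zero    zero    z≤n = S₁-diagonal-zero
    S₁≈stirlingSum (suc n) zero    z≤n = S₁-column-zero n
    S₁≈stirlingSum (suc n) (suc k) (s≤s k≤n) with ℕₚ.m≤n⇒∃[o]m+o≡n k≤n
    ... | L , ≡.refl = trans (S₁-expansion k L) (sym (stirlingSum-suc k L))

theorem3p6 : ∀ {c ℓ} (R : CommutativeRing c ℓ) (F : Char0Field R) →
  let open CommutativeRing R
      open Char0Field F
      open Series R F
  in (m : ℕ → Carrier) → m 0 ≈ 1# → ¬ (m 1 ≈ 0#) →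
     (ebar : ℕ → Carrier) → IsCompInverse (eSeries m) ebar →
     ∀ n k → k ≤ n →
     S₁ ebar n k ≈
       Σ< (ℕ.suc (n ∸ k)) (λ j →
         ℕ→R R ((n ℕ.+ j ∸ 1) C (n ℕ.+ j ∸ k)) * ℕ→R R ((2 ℕ.* n ∸ k) C (n ∸ k ∸ j))
           * sign j * pow (inv (m 1)) (n ℕ.+ j) * S₂ m (n ∸ k ℕ.+ j) j)
theorem3p6 R F m m₀≈1 m₁≉0 ebar (_ , _ , ebar∘e≈idS) = S₁≈stirlingSum m m₀≈1 m₁≉0 ebar ebar∘e≈idS
  where open StirlingInversion R F
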